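{- Let $G$ be a labeled graph of size $n$ and $\tau$ its modular decomposition tree. Let $d_1,\dots,d_k$ be the numbers of children of the linear nodes of $\tau$ and $e_1,\dots,e_j$ the numbers of children of the non-linear nodes of $\tau$. Then $G$ has exactly $\prod_{i=1}^k (2d_i-3)!!$ expanded trees, and each of them has $2n-2-\sum_{i=1}^{j}(e_i-2)$ edges.
   Context: A substitution tree is a rooted non-plane tree with leaves labeled bijectively by $\{1,\dots,n\}$, internal nodes decorated either by $\oplus$/$\ominus$ (linear nodes, at least 2 children) or by a labeled graph $H$ with $|H|\ge 2$ and exactly $|H|$ children; $\mathrm{Graph}(t)$ is defined recursively by graph substitution (children ordered by minimal leaf label; $\oplus$ = complete graph, $\ominus$ = edgeless graph; in $H[G_1,\dots,G_k]$ vertices of $G_i$ and $G_j$, $i\ne j$, are adjacent iff $i,j$ are adjacent in $H$). A graph is prime if it has at least 3 vertices and only trivial modules (a module being a vertex set $M$ such that each vertex outside $M$ is adjacent to all or none of $M$). The modular decomposition tree of $G$ is the unique substitution tree of $G$ whose non-linear nodes are decorated by prime graphs and in which no $\oplus$ (resp. $\ominus$) node has a $\oplus$ (resp. $\ominus$) child. An expanded tree of $G$ is a substitution tree $t$ with $\mathrm{Graph}(t)=G$ whose non-linear nodes are decorated by prime graphs and whose linear nodes all have exactly two children. $(2m-3)!!=1\cdot3\cdots(2m-3)$. -}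

module Defs where

open import Data.Nat using (ℕ; zero; suc; _+_; _*_; _∸_; _≤_; _<_; _⊓_)
open import Data.Bool using (Bool; true; false; if_then_else_; _∧_)
open import Data.Fin using (Fin; toℕ; _≟_)
import Data.Fin as Fin
import Data.Maybe
open import Data.Fin.Subset using (Subset; _∈_; _∉_; ∣_∣)
import Data.Fin.Subset
open import Data.Vec using (Vec; []; _∷_; lookup; toList)
open import Data.List using (List; []; _∷_; map; length; foldr; _++_; allFin)
open import Data.List.Relation.Unary.Linked using (Linked)
open import Data.List.Relation.Unary.All using (All)
open import Data.List.Relation.Unary.Any using (any?)
open import Data.List.Relation.Binary.Permutation.Propositional using (_↭_)
open import Data.Maybe using (Maybe; just; nothing)
open import Data.Product using (_×_)
open import Data.Sum using (_⊎_)
open import Data.Unit renaming (⊤ to Unit) using ()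
open import Relation.Nullary using (¬_; does)
open import Relation.Binary.PropositionalEquality using (_≡_; _≢_)

record LabeledGraph (n : ℕ) : Set where
  field
    adj    : Fin n → Fin n → Bool
    sym    : ∀ a b → adj a b ≡ adj b a
    irrefl : ∀ a → adj a a ≡ false

Mat : ℕ → Set
Mat k = Vec (Vec Bool k) k

matAdj : ∀ {k} → Mat k → Fin k → Fin k → Bool
matAdj H i j = lookup (lookup H i) j

IsGraphMat : ∀ {k} → Mat k → Set
IsGraphMat H = (∀ i j → matAdj H i j ≡ matAdj H j i) × (∀ i → matAdj H i i ≡ false)

IsModule : ∀ {k} → (Fin k → Fin k → Bool) → Subset k → Set
IsModule A M = ∀ x y z → x ∉ M → y ∈ M → z ∈ M → A x y ≡ A x z

IsTrivialModule : ∀ {k} → Subset k → Set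
IsTrivialModule M = ∣ M ∣ ≤ 1 ⊎ M ≡ Data.Fin.Subset.⊤

IsPrime : ∀ {k} → (Fin k → Fin k → Bool) → Set
IsPrime {k} A = 3 ≤ k × (∀ M → IsModule A M → IsTrivialModule M)

-- Raw substitution trees with leaves labeled in Fin n.
--  lin true  = ⊕ node, lin false = ⊖ node (children as a list),
--  gnode k H ts = node decorated by the graph H on Fin k with k children;
--  child number i (in the canonical order by minimal leaf label) is
--  substituted for vertex i of H.

data Tree (n : ℕ) : Set where
  leaf  : Fin n → Tree n
  lin   : Bool → List (Tree n) → Tree n
  gnode : (k : ℕ) → Mat k → Vec (Tree n) k → Tree n

module _ {n : ℕ} where

  mutual
    leaves : Tree n → List (Fin n)
    leaves (leaf a) = a ∷ []
    leaves (lin s ts) = leavesL ts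
    leaves (gnode k H ts) = leavesV ts

    leavesL : List (Tree n) → List (Fin n)
    leavesL [] = []
    leavesL (t ∷ ts) = leaves t ++ leavesL ts

    leavesV : ∀ {k} → Vec (Tree n) k → List (Fin n)
    leavesV [] = []
    leavesV (t ∷ ts) = leaves t ++ leavesV ts

  minLeaf : Tree n → ℕ
  minLeaf t = foldr _⊓_ n (map toℕ (leaves t))

  memT : Tree n → Fin n → Bool
  memT t a = does (any? (a ≟_) (leaves t))

  memL : List (Tree n) → Fin n → Bool
  memL ts a = does (any? (a ≟_) (leavesL ts))

  posV : ∀ {k} → Vec (Tree n) k → Fin n → Maybe (Fin k)
  posV [] a = nothing
  posV (t ∷ ts) a = if memT t a then just Fin.zero
                    else Data.Maybe.map Fin.suc (posV ts a)

  mutual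
    adj : Tree n → Fin n → Fin n → Bool
    adj (leaf _) a b = false
    adj (lin s ts) a b = adjLin s ts a b
    adj (gnode k H ts) a b with posV ts a | posV ts b
    ... | just i | just j = if does (i ≟ j) then adjAtV ts i a b else matAdj H i j
    ... | _ | _ = false

    adjLin : Bool → List (Tree n) → Fin n → Fin n → Bool
    adjLin s [] a b = false
    adjLin s (t ∷ ts) a b =
      if memT t a
        then (if memT t b then adj t a b else (memL ts b ∧ s))
        else (if memT t b then (memL ts a ∧ s) else adjLin s ts a b)

    adjAtV : ∀ {k} → Vec (Tree n) k → Fin k → Fin n → Fin n → Bool
    adjAtV (t ∷ ts) Fin.zero a b = adj t a b
    adjAtV (t ∷ ts) (Fin.suc i) a b = adjAtV ts i a b

  mutual
    Every : (Tree n → Set) → Tree n → Set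
    Every P (leaf a) = P (leaf a)
    Every P (lin s ts) = P (lin s ts) × EveryL P ts
    Every P (gnode k H ts) = P (gnode k H ts) × EveryV P ts

    EveryL : (Tree n → Set) → List (Tree n) → Set
    EveryL P [] = Unit
    EveryL P (t ∷ ts) = Every P t × EveryL P ts

    EveryV : ∀ {k} → (Tree n → Set) → Vec (Tree n) k → Set
    EveryV P [] = Unit
    EveryV P (t ∷ ts) = Every P t × EveryV P ts

  WFLocal : Tree n → Set
  WFLocal (leaf _) = Unit
  WFLocal (lin s ts) = 2 ≤ length ts × Linked _<_ (map minLeaf ts)
  WFLocal (gnode k H ts) = 2 ≤ k × IsGraphMat H × Linked _<_ (map minLeaf (toList ts))

  IsSubstTree : Tree n → Set
  IsSubstTree t = Every WFLocal t × (leaves t ↭ allFin n)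

  Realizes : Tree n → LabeledGraph n → Set
  Realizes t G = ∀ a b → adj t a b ≡ LabeledGraph.adj G a b

  PrimeLocal : Tree n → Set
  PrimeLocal (gnode k H ts) = IsPrime (matAdj H)
  PrimeLocal _ = Unit

  linSign : Tree n → Maybe Bool
  linSign (lin s _) = just s
  linSign _ = nothing

  ReducedLocal : Tree n → Set
  ReducedLocal (lin s ts) = All (λ c → linSign c ≢ just s) ts
  ReducedLocal _ = Unit

  BinaryLocal : Tree n → Set
  BinaryLocal (lin s ts) = length ts ≡ 2
  BinaryLocal _ = Unit

  IsModDecTree : LabeledGraph n → Tree n → Set
  IsModDecTree G t = IsSubstTree t × Realizes t G × Every PrimeLocal t × Every ReducedLocal t

  IsExpandedTree : LabeledGraph n → Tree n → Set
  IsExpandedTree G t = IsSubstTree t × Realizes t G × Every PrimeLocal t × Every BinaryLocal t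

  mutual
    linDegrees : Tree n → List ℕ
    linDegrees (leaf _) = []
    linDegrees (lin s ts) = length ts ∷ linDegreesL ts
    linDegrees (gnode k H ts) = linDegreesV ts

    linDegreesL : List (Tree n) → List ℕ
    linDegreesL [] = []
    linDegreesL (t ∷ ts) = linDegrees t ++ linDegreesL ts

    linDegreesV : ∀ {k} → Vec (Tree n) k → List ℕ
    linDegreesV [] = []
    linDegreesV (t ∷ ts) = linDegrees t ++ linDegreesV ts

  mutual
    nonlinDegrees : Tree n → List ℕ
    nonlinDegrees (leaf _) = []
    nonlinDegrees (lin s ts) = nonlinDegreesL ts
    nonlinDegrees (gnode k H ts) = k ∷ nonlinDegreesV ts

    nonlinDegreesL : List (Tree n) → List ℕ
    nonlinDegreesL [] = []
    nonlinDegreesL (t ∷ ts) = nonlinDegrees t ++ nonlinDegreesL ts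

    nonlinDegreesV : ∀ {k} → Vec (Tree n) k → List ℕ
    nonlinDegreesV [] = []
    nonlinDegreesV (t ∷ ts) = nonlinDegrees t ++ nonlinDegreesV ts

  mutual
    edges : Tree n → ℕ
    edges (leaf _) = 0
    edges (lin s ts) = edgesL ts
    edges (gnode k H ts) = edgesV ts

    edgesL : List (Tree n) → ℕ
    edgesL [] = 0
    edgesL (t ∷ ts) = suc (edges t) + edgesL ts

    edgesV : ∀ {k} → Vec (Tree n) k → ℕ
    edgesV [] = 0
    edgesV (t ∷ ts) = suc (edges t) + edgesV ts

_!! : ℕ → ℕ
zero !! = 1
suc zero !! = 1
suc (suc m) !! = suc (suc m) * (m !!)

-- Expanded trees of G are exactly the refinements of its modular decomposition tree τ in which every
-- linear node with d children is replaced by a binary tree of linear nodes of the same sign over expanded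
-- trees of those children, and every prime node is kept.  Prime nodes cannot be refined since a prime graph
-- has no nontrivial module, and an s-node of an expanded tree can only group children of an s-node of τ,
-- because the leaves of any node of τ that is not an s-node admit no cut with all cross adjacencies s.
-- Since d tips have (2d-3)!! binary trees and τ is reduced, the refinements are distinct and counted by the
-- product.  A tree on n leaves whose linear nodes are binary has 2n - 2 edges, less e - 2 for each prime
-- node with e children.
module Submission where

open import Defs
open import Data.Bool using (Bool; true; false; not) renaming (_≟_ to _≟B_)
open import Data.Empty using (⊥; ⊥-elim)
open import Data.Fin using (Fin; toℕ; zero; suc; _≟_)
open import Data.Fin.Properties using (toℕ<n)
open import Data.Fin.Subset using (Subset; ∣_∣; ⁅_⁆; ∁) renaming (_∈_ to _∈S_; _∉_ to _∉S_)
open import Data.Fin.Subset.Properties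
  using (∈⊤; x∈⁅x⁆; x∈⁅y⁆⇒x≡y; x≢y⇒x∉⁅y⁆; x∉⁅y⁆⇒x≢y;
         x∈p⇒x∉∁p; x∈∁p⇒x∉p; x∉p⇒x∈∁p; x∉∁p⇒x∈p)
open import Data.List using (List; []; _∷_; _++_; length; map; concatMap; foldr; allFin)
open import Data.List.Properties using (length-map; map-++; length-++; ++-identityʳ; length-tabulate; ∷-injectiveˡ; ∷-injectiveʳ)
import Data.List.Properties as Listₚ
open import Data.List.Membership.Propositional using (_∈_; _∉_; find; lose)
open import Data.List.Membership.Propositional.Properties
  using (∈-++⁺ˡ; ∈-++⁺ʳ; ∈-++⁻; ∈-map⁺; ∈-map⁻; ∈-concatMap⁺; ∈-concatMap⁻; foldr-selective; ∈-allFin; ∈-length)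
open import Data.List.Relation.Unary.Any using (Any; here; there; any?)
open import Data.List.Relation.Unary.All using (All; []; _∷_)
import Data.List.Relation.Unary.All as All
import Data.List.Relation.Unary.All.Properties as AllP
open import Data.List.Relation.Unary.AllPairs using (AllPairs; []; _∷_)
import Data.List.Relation.Unary.AllPairs.Properties as AllPairsP
open import Data.List.Relation.Unary.Linked using (Linked; []; [-]; _∷_)
open import Data.List.Relation.Unary.Linked.Properties using (Linked⇒AllPairs)
open import Data.List.Relation.Unary.Unique.Propositional using (Unique)
import Data.List.Relation.Unary.Unique.Propositional.Properties as UniqueP
open import Data.List.Relation.Binary.Pointwise using (Pointwise; []; _∷_; Pointwise-length)
import Data.List.Relation.Binary.Pointwise as Pointwiseₗ
open import Data.List.Relation.Binary.Permutation.Propositional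
  using (_↭_; ↭-refl; ↭-sym; ↭-trans; ↭-reflexive; prep; swap; ↭⇒↭ₛ; module PermutationReasoning)
import Data.List.Relation.Binary.Permutation.Propositional as Perm
open import Data.List.Relation.Binary.Permutation.Propositional.Properties
  using (++⁺; ++⁺ʳ; ++⁺ˡ; ++-comm; ∈-resp-↭; ↭-length; ++-assoc; map⁺)
import Data.List.Relation.Binary.Permutation.Setoid.Properties as PermSetoidP
open import Data.List.Relation.Ternary.Interleaving.Propositional
  using (Interleaving; []; consˡ; consʳ; toPermutation) renaming (swap to Interleaving-swap)
open import Data.List.Relation.Ternary.Interleaving.Propositional.Properties using () renaming (filter⁺ to filter-interleaving)
open import Data.Maybe using (just)
open import Data.Maybe.Properties using (just-injective)
open import Data.Nat using (ℕ; zero; suc; _+_; _*_; _∸_; _≤_; _<_; _⊓_; z≤n; s≤s)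
open import Data.Nat.Properties
  using (module ≤-Reasoning; *-comm; *-suc; *-distribˡ-+; +-comm; +-identityʳ; +-monoʳ-≤; +-monoˡ-≤; m+n∸n≡m;
         ≤-refl; ≤-trans; ≤-antisym; ≤-pred; ≤-<-trans; <⇒≤; <-trans; <-irrefl; <-asym; suc-injective; n≤0⇒n≡0;
         m≤m+n; m≤n+m; ⊓-sel; ⊓-assoc; m⊓n≤m; m⊓n≤n; m≤n⇒m⊓n≡m; m≥n⇒m⊓n≡n)
open import Data.Nat.ListAction using (product; sum)
open import Data.Nat.ListAction.Properties using (product-++; sum-++; sum-↭)
open import Data.Nat.Tactic.RingSolver using (solve-∀)
open import Data.Product using (Σ; _×_; _,_; proj₁; proj₂)
open import Data.Sum using (_⊎_; inj₁; inj₂)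
open import Data.Unit using (⊤; tt)
open import Data.Vec using (Vec; []; _∷_; lookup; tabulate; toList)
open import Data.Vec.Base using (here; there)
open import Data.Vec.Properties using ([]=⇒lookup; lookup⇒[]=; lookup∘tabulate; length-toList)
import Data.Vec.Properties as Vecₚ
import Data.Vec.Relation.Binary.Pointwise.Inductive as Pointwiseᵥ
open Pointwiseᵥ using ([]; _∷_; Pointwise-≡⇒≡)
open import Data.Vec.Relation.Binary.Pointwise.Extensional using (ext; extensional⇒inductive)
open import Function.Base using (_∘_; id)
open import Function.Bundles using (_⇔_; mk⇔)
open import Relation.Nullary using (¬_; Dec; does; yes; no; ¬?)
open import Relation.Nullary.Decidable using (dec-true; dec-false)
open import Relation.Unary using (Decidable)
open import Relation.Binary.PropositionalEquality

module _ {A : Set} where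

  Unique-++⁻ˡ : ∀ {xs ys : List A} → Unique (xs ++ ys) → Unique xs
  Unique-++⁻ˡ {[]} u = []
  Unique-++⁻ˡ {x ∷ xs} (x∉ ∷ u) = AllP.++⁻ˡ xs x∉ ∷ Unique-++⁻ˡ u

  Unique-++⁻ʳ : ∀ (xs : List A) {ys} → Unique (xs ++ ys) → Unique ys
  Unique-++⁻ʳ [] u = u
  Unique-++⁻ʳ (x ∷ xs) (_ ∷ u) = Unique-++⁻ʳ xs u

  Unique-++⇒disjoint : ∀ {xs ys : List A} → Unique (xs ++ ys) → ∀ {a} → a ∈ xs → a ∈ ys → ⊥
  Unique-++⇒disjoint {x ∷ xs} (x∉ ∷ u) (here refl) a∈ys = All.lookup (AllP.++⁻ʳ xs x∉) a∈ys refl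
  Unique-++⇒disjoint {x ∷ xs} (_ ∷ u) (there a∈xs) a∈ys = Unique-++⇒disjoint u a∈xs a∈ys

  Unique-resp-↭ : ∀ {xs ys : List A} → xs ↭ ys → Unique xs → Unique ys
  Unique-resp-↭ p = PermSetoidP.Unique-resp-↭ (setoid A) (↭⇒↭ₛ p)

  partition-interleaving : ∀ {P : A → Set} → Decidable P → (cs : List A) →
    Σ (List A) λ xs → Σ (List A) λ ys → Interleaving xs ys cs × All P xs × All (¬_ ∘ P) ys
  partition-interleaving P? cs =
    _ , _ , filter-interleaving P? cs , AllP.all-filter P? cs , AllP.all-filter (¬? ∘ P?) cs

  Interleaving-∈ : ∀ {xs ys cs : List A} {c} → Interleaving xs ys cs → c ∈ cs → c ∈ xs ⊎ c ∈ ys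
  Interleaving-∈ {xs} i c∈cs = ∈-++⁻ xs (∈-resp-↭ (toPermutation i) c∈cs)

  Interleaving-∈ˡ : ∀ {xs ys cs : List A} {c} → Interleaving xs ys cs → c ∈ xs → c ∈ cs
  Interleaving-∈ˡ i c∈xs = ∈-resp-↭ (↭-sym (toPermutation i)) (∈-++⁺ˡ c∈xs)

  Interleaving-∈ʳ : ∀ {xs ys cs : List A} {c} → Interleaving xs ys cs → c ∈ ys → c ∈ cs
  Interleaving-∈ʳ {xs} i c∈ys = ∈-resp-↭ (↭-sym (toPermutation i)) (∈-++⁺ʳ xs c∈ys)

  module _ {R : A → A → Set} where

    AllPairs-interleavingˡ : ∀ {xs ys cs : List A} → Interleaving xs ys cs → AllPairs R cs → AllPairs R xs
    AllPairs-interleavingˡ [] _ = []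
    AllPairs-interleavingˡ (consˡ i) (r ∷ rs) =
      All.tabulate (λ m → All.lookup r (Interleaving-∈ˡ i m)) ∷ AllPairs-interleavingˡ i rs
    AllPairs-interleavingˡ (consʳ i) (_ ∷ rs) = AllPairs-interleavingˡ i rs

    AllPairs-interleavingʳ : ∀ {xs ys cs : List A} → Interleaving xs ys cs → AllPairs R cs → AllPairs R ys
    AllPairs-interleavingʳ [] _ = []
    AllPairs-interleavingʳ (consʳ i) (r ∷ rs) =
      All.tabulate (λ m → All.lookup r (Interleaving-∈ʳ i m)) ∷ AllPairs-interleavingʳ i rs
    AllPairs-interleavingʳ (consˡ i) (_ ∷ rs) = AllPairs-interleavingʳ i rs

module _ {A B : Set} where

  Unique-map⁺-on : ∀ (f : A → B) {xs} → Unique xs →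
    (∀ {x y} → x ∈ xs → y ∈ xs → f x ≡ f y → x ≡ y) → Unique (map f xs)
  Unique-map⁺-on f {[]} _ _ = []
  Unique-map⁺-on f {x ∷ xs} (x∉ ∷ u) inj =
    All.tabulate (λ z∈ fx≡z → let (y , y∈ , z≡fy) = ∈-map⁻ f z∈ in
                   All.lookup x∉ y∈ (inj (here refl) (there y∈) (trans fx≡z z≡fy)))
    ∷ Unique-map⁺-on f u (λ x∈ y∈ → inj (there x∈) (there y∈))

  Unique-concatMap⁺ : ∀ (f : A → List B) {xs} → Unique xs → (∀ {x} → x ∈ xs → Unique (f x)) →
    (∀ {x y u} → x ∈ xs → y ∈ xs → u ∈ f x → u ∈ f y → x ≡ y) → Unique (concatMap f xs)
  Unique-concatMap⁺ f {[]} _ _ _ = []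
  Unique-concatMap⁺ f {x ∷ xs} (x∉ ∷ u) uf disj =
    UniqueP.++⁺ (uf (here refl)) (Unique-concatMap⁺ f u (uf ∘ there) (λ x∈ y∈ → disj (there x∈) (there y∈)))
      λ (u∈fx , u∈rest) → let (y , y∈ , u∈fy) = find (∈-concatMap⁻ f {xs = xs} u∈rest) in
        All.lookup x∉ y∈ (disj (here refl) (there y∈) u∈fx u∈fy)

  length-concatMap-const : ∀ (f : A → List B) c xs → (∀ {x} → x ∈ xs → length (f x) ≡ c) →
    length (concatMap f xs) ≡ length xs * c
  length-concatMap-const f c [] _ = refl
  length-concatMap-const f c (x ∷ xs) h =
    trans (length-++ (f x)) (cong₂ _+_ (h (here refl)) (length-concatMap-const f c xs (h ∘ there)))

  Pointwise-∈ʳ : ∀ {R : A → B → Set} {as bs b} → Pointwise R as bs → b ∈ bs → Σ A λ a → a ∈ as × R a b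
  Pointwise-∈ʳ (r ∷ _) (here refl) = _ , here refl , r
  Pointwise-∈ʳ (_ ∷ p) (there b∈) = let (a , a∈ , r) = Pointwise-∈ʳ p b∈ in a , there a∈ , r

  Pointwise-∈ˡ : ∀ {R : A → B → Set} {as bs a} → Pointwise R as bs → a ∈ as → Σ B λ b → b ∈ bs × R a b
  Pointwise-∈ˡ (r ∷ _) (here refl) = _ , here refl , r
  Pointwise-∈ˡ (_ ∷ p) (there a∈) = let (b , b∈ , r) = Pointwise-∈ˡ p a∈ in b , there b∈ , r

  Pointwise-sorted : ∀ (κ : A → ℕ) (κ′ : B → ℕ) {as bs} → Pointwise (λ a b → κ a ≡ κ′ b) as bs →
    AllPairs (λ b b′ → κ′ b < κ′ b′) bs → AllPairs (λ a a′ → κ a < κ a′) as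
  Pointwise-sorted κ κ′ [] [] = []
  Pointwise-sorted κ κ′ (e ∷ p) (r ∷ rs) = head-below p r ∷ Pointwise-sorted κ κ′ p rs
    where
      head-below : ∀ {as bs} → Pointwise (λ a b → κ a ≡ κ′ b) as bs →
        All (λ b′ → κ′ _ < κ′ b′) bs → All (λ a′ → κ _ < κ a′) as
      head-below [] [] = []
      head-below (e′ ∷ p′) (r′ ∷ rs′) = subst₂ _<_ (sym e) (sym e′) r′ ∷ head-below p′ rs′

module _ {A : Set} (κ : A → ℕ) where

  sorted-≡ : ∀ {xs ys : List A} → AllPairs (λ p q → κ p < κ q) xs → AllPairs (λ p q → κ p < κ q) ys →
    (∀ {z} → z ∈ xs → z ∈ ys) → (∀ {z} → z ∈ ys → z ∈ xs) → xs ≡ ys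
  sorted-≡ {[]} {[]} _ _ _ _ = refl
  sorted-≡ {[]} {y ∷ ys} _ _ _ ys⊆ with () ← ys⊆ (here refl)
  sorted-≡ {x ∷ xs} {[]} _ _ xs⊆ _ with () ← xs⊆ (here refl)
  sorted-≡ {x ∷ xs} {y ∷ ys} (x< ∷ sx) (y< ∷ sy) xs⊆ ys⊆ with xs⊆ (here refl) | ys⊆ (here refl)
  ... | here refl | _ = cong (x ∷_) (sorted-≡ sx sy (tail-⊆ x< xs⊆) (tail-⊆ y< ys⊆))
    where
      tail-⊆ : ∀ {u us vs} → All (λ w → κ u < κ w) us → (∀ {z} → z ∈ u ∷ us → z ∈ u ∷ vs) →
        ∀ {z} → z ∈ us → z ∈ vs
      tail-⊆ u< ⊆ z∈ with ⊆ (there z∈)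
      ... | here refl = ⊥-elim (<-irrefl refl (All.lookup u< z∈))
      ... | there z∈′ = z∈′
  ... | there x∈ys | here refl = ⊥-elim (<-irrefl refl (All.lookup y< x∈ys))
  ... | there x∈ys | there y∈xs = ⊥-elim (<-asym (All.lookup y< x∈ys) (All.lookup x< y∈xs))

module _ {A : Set} where

  ∈-toList⁻ : ∀ {k} {v : Vec A k} {x} → x ∈ toList v → Σ (Fin k) λ i → x ≡ lookup v i
  ∈-toList⁻ {v = _ ∷ _} (here refl) = zero , refl
  ∈-toList⁻ {v = _ ∷ _} (there m) = let (i , e) = ∈-toList⁻ m in suc i , e

  ∈-toList⁺ : ∀ {k} (v : Vec A k) (i : Fin k) → lookup v i ∈ toList v
  ∈-toList⁺ (_ ∷ _) zero = here refl
  ∈-toList⁺ (_ ∷ v) (suc i) = there (∈-toList⁺ v i)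

  module _ (κ : A → ℕ) where

    map-toList-≡⇒lookup : ∀ {k} (u v : Vec A k) → map κ (toList u) ≡ map κ (toList v) →
      ∀ i → κ (lookup u i) ≡ κ (lookup v i)
    map-toList-≡⇒lookup (_ ∷ _) (_ ∷ _) e zero = ∷-injectiveˡ e
    map-toList-≡⇒lookup (_ ∷ u) (_ ∷ v) e (suc i) = map-toList-≡⇒lookup u v (∷-injectiveʳ e) i

    sorted⇒lookup-injective : ∀ {k} (v : Vec A k) → AllPairs _<_ (map κ (toList v)) →
      ∀ i j → κ (lookup v i) ≡ κ (lookup v j) → i ≡ j
    sorted⇒lookup-injective (_ ∷ _) _ zero zero _ = refl
    sorted⇒lookup-injective (_ ∷ v) (r ∷ _) zero (suc j) e =
      ⊥-elim (<-irrefl e (All.lookup r (∈-map⁺ κ (∈-toList⁺ v j))))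
    sorted⇒lookup-injective (_ ∷ v) (r ∷ _) (suc i) zero e =
      ⊥-elim (<-irrefl (sym e) (All.lookup r (∈-map⁺ κ (∈-toList⁺ v i))))
    sorted⇒lookup-injective (_ ∷ v) (_ ∷ rs) (suc i) (suc j) e = cong suc (sorted⇒lookup-injective v rs i j e)

module _ {A B : Set} {R : A → B → Set} where

  Pointwise-interleaving : ∀ {xs ys cs : List B} {as bs} → Interleaving xs ys cs → Pointwise R as xs → Pointwise R bs ys →
    Σ (List A) λ es → Interleaving as bs es × Pointwise R es cs
  Pointwise-interleaving [] [] [] = [] , [] , []
  Pointwise-interleaving (consˡ i) (r ∷ rs) rs′ =
    let (es , j , es≈) = Pointwise-interleaving i rs rs′ in _ , consˡ j , r ∷ es≈
  Pointwise-interleaving (consʳ i) rs (r ∷ rs′) =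
    let (es , j , es≈) = Pointwise-interleaving i rs rs′ in _ , consʳ j , r ∷ es≈

-- Prime graphs

module _ {k : ℕ} {f : Fin k → Bool} {x : Fin k} where

  ∈-tabulate⁺ : f x ≡ true → x ∈S tabulate f
  ∈-tabulate⁺ fx = lookup⇒[]= x (tabulate f) (trans (lookup∘tabulate f x) fx)

  ∈-tabulate⁻ : x ∈S tabulate f → f x ≡ true
  ∈-tabulate⁻ x∈ = trans (sym (lookup∘tabulate f x)) ([]=⇒lookup x∈)

  ∉-tabulate⁺ : f x ≡ false → x ∉S tabulate f
  ∉-tabulate⁺ fx x∈ with () ← trans (sym fx) (∈-tabulate⁻ x∈)

  ∉-tabulate⁻ : x ∉S tabulate f → f x ≡ false
  ∉-tabulate⁻ x∉ with f x in fx
  ... | true = ⊥-elim (x∉ (∈-tabulate⁺ fx))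
  ... | false = refl

∣p∣≡0⇒x∉p : ∀ {k} (p : Subset k) → ∣ p ∣ ≡ 0 → ∀ {x} → x ∉S p
∣p∣≡0⇒x∉p (true ∷ p) () here
∣p∣≡0⇒x∉p (true ∷ p) () (there _)
∣p∣≡0⇒x∉p (false ∷ p) ∣p∣≡0 (there x∈) = ∣p∣≡0⇒x∉p p ∣p∣≡0 x∈

∣p∣≤1⇒x≡y : ∀ {k} (p : Subset k) → ∣ p ∣ ≤ 1 → ∀ {x y} → x ∈S p → y ∈S p → x ≡ y
∣p∣≤1⇒x≡y (true ∷ p) _ here here = refl
∣p∣≤1⇒x≡y (true ∷ p) (s≤s ∣p∣≤0) here (there y∈) = ⊥-elim (∣p∣≡0⇒x∉p p (n≤0⇒n≡0 ∣p∣≤0) y∈)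
∣p∣≤1⇒x≡y (true ∷ p) (s≤s ∣p∣≤0) (there x∈) _ = ⊥-elim (∣p∣≡0⇒x∉p p (n≤0⇒n≡0 ∣p∣≤0) x∈)
∣p∣≤1⇒x≡y (false ∷ p) ∣p∣≤1 (there x∈) (there y∈) = cong suc (∣p∣≤1⇒x≡y p ∣p∣≤1 x∈ y∈)

two-in-one-out⇒¬trivial : ∀ {k} {M : Subset k} {x y z} →
  x ∈S M → y ∈S M → x ≢ y → z ∉S M → ¬ IsTrivialModule M
two-in-one-out⇒¬trivial x∈ y∈ x≢y _ (inj₁ ∣M∣≤1) = x≢y (∣p∣≤1⇒x≡y _ ∣M∣≤1 x∈ y∈)
two-in-one-out⇒¬trivial _ _ _ z∉ (inj₂ refl) = z∉ ∈⊤

third-vertex : ∀ {k} → 3 ≤ k → (i j : Fin k) → Σ (Fin k) λ q → q ≢ i × q ≢ j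
third-vertex (s≤s (s≤s (s≤s _))) zero zero = suc zero , (λ ()) , (λ ())
third-vertex (s≤s (s≤s (s≤s _))) zero (suc zero) = suc (suc zero) , (λ ()) , (λ ())
third-vertex (s≤s (s≤s (s≤s _))) zero (suc (suc j)) = suc zero , (λ ()) , (λ ())
third-vertex (s≤s (s≤s (s≤s _))) (suc zero) zero = suc (suc zero) , (λ ()) , (λ ())
third-vertex (s≤s (s≤s (s≤s _))) (suc (suc i)) zero = suc zero , (λ ()) , (λ ())
third-vertex (s≤s (s≤s (s≤s _))) (suc i) (suc j) = zero , (λ ()) , (λ ())

-- All vertices but r form a module as soon as r sees them uniformly.
prime⇒no-uniform-vertex : ∀ {k} (B : Fin k → Fin k → Bool) → IsPrime B → (r : Fin k) →
  ¬ (∀ q q′ → q ≢ r → q′ ≢ r → B r q ≡ B r q′)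
prime⇒no-uniform-vertex B (3≤k , prime) r uniform =
  let (q₁ , q₁≢r , _) = third-vertex 3≤k r r
      (q₂ , q₂≢r , q₂≢q₁) = third-vertex 3≤k r q₁
  in two-in-one-out⇒¬trivial (≢r⇒∈M q₁≢r) (≢r⇒∈M q₂≢r) (λ e → q₂≢q₁ (sym e))
       (x∈p⇒x∉∁p (x∈⁅x⁆ r)) (prime M M-module)
  where
    M = ∁ ⁅ r ⁆
    ≢r⇒∈M : ∀ {x} → x ≢ r → x ∈S M
    ≢r⇒∈M x≢r = x∉p⇒x∈∁p (x≢y⇒x∉⁅y⁆ x≢r)
    ∈M⇒≢r : ∀ {x} → x ∈S M → x ≢ r
    ∈M⇒≢r x∈ = x∉⁅y⁆⇒x≢y (x∈∁p⇒x∉p x∈)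
    M-module : IsModule B M
    M-module x y z x∉M y∈M z∈M with refl ← x∈⁅y⁆⇒x≡y r (x∉∁p⇒x∈p x∉M) =
      uniform y z (∈M⇒≢r y∈M) (∈M⇒≢r z∈M)

-- Binary trees

data BinTree (X : Set) : Set where
  tip : X → BinTree X
  fork : BinTree X → BinTree X → BinTree X

module _ {X : Set} where

  tips : BinTree X → List X
  tips (tip a) = a ∷ []
  tips (fork x y) = tips x ++ tips y

  forks : BinTree X → ℕ
  forks (tip _) = 0
  forks (fork x y) = suc (forks x + forks y)

  -- b becomes the new sibling of some subtree, and the fork containing b is put first.
  mutual
    insertions : X → BinTree X → List (BinTree X)
    insertions b t = fork (tip b) t ∷ insertionsBelow b t

    insertionsBelow : X → BinTree X → List (BinTree X)
    insertionsBelow b (tip _) = []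
    insertionsBelow b (fork x y) = map (λ x′ → fork x′ y) (insertions b x) ++ map (λ y′ → fork y′ x) (insertions b y)

  -- Every binary tree over b ∷ bs is an insertion of b into a binary tree over bs.
  binTrees : List X → List (BinTree X)
  binTrees [] = []
  binTrees (b ∷ []) = tip b ∷ []
  binTrees (b ∷ c ∷ bs) = concatMap (insertions b) (binTrees (c ∷ bs))

  data Insertion (b : X) : BinTree X → BinTree X → Set where
    at-root : ∀ {t} → Insertion b t (fork (tip b) t)
    in-left : ∀ {x y x′} → x′ ∈ insertions b x → Insertion b (fork x y) (fork x′ y)
    in-right : ∀ {x y y′} → y′ ∈ insertions b y → Insertion b (fork x y) (fork y′ x)

  insertion-view : ∀ {b t u} → u ∈ insertions b t → Insertion b t u
  insertion-view (here refl) = at-root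
  insertion-view {b} {fork x y} (there u∈) with ∈-++⁻ (map (λ x′ → fork x′ y) (insertions b x)) u∈
  ... | inj₁ u∈ˡ with _ , x′∈ , refl ← ∈-map⁻ (λ x′ → fork x′ y) u∈ˡ = in-left x′∈
  ... | inj₂ u∈ʳ with _ , y′∈ , refl ← ∈-map⁻ (λ y′ → fork y′ x) u∈ʳ = in-right y′∈

  ∈-insertions-left : ∀ {b x y x′} → x′ ∈ insertions b x → fork x′ y ∈ insertions b (fork x y)
  ∈-insertions-left {y = y} x′∈ = there (∈-++⁺ˡ (∈-map⁺ (λ x′ → fork x′ y) x′∈))

  ∈-insertions-right : ∀ {b x y y′} → y′ ∈ insertions b y → fork y′ x ∈ insertions b (fork x y)
  ∈-insertions-right {b} {x} {y} y′∈ =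
    there (∈-++⁺ʳ (map (λ x′ → fork x′ y) (insertions b x)) (∈-map⁺ (λ y′ → fork y′ x) y′∈))

  tip∉insertions : ∀ {b t a} → tip a ∉ insertions b t
  tip∉insertions a∈ with () ← insertion-view a∈

  length-insertions : ∀ b t → length (insertions b t) ≡ suc (2 * forks t)
  length-insertions b (tip _) = refl
  length-insertions b (fork x y) = cong suc (begin
    length (map (λ x′ → fork x′ y) (insertions b x) ++ map (λ y′ → fork y′ x) (insertions b y))
      ≡⟨ length-++ (map (λ x′ → fork x′ y) (insertions b x)) ⟩
    length (map (λ x′ → fork x′ y) (insertions b x)) + length (map (λ y′ → fork y′ x) (insertions b y))
      ≡⟨ cong₂ _+_ (length-map _ (insertions b x)) (length-map _ (insertions b y)) ⟩
    length (insertions b x) + length (insertions b y)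
      ≡⟨ cong₂ _+_ (length-insertions b x) (length-insertions b y) ⟩
    suc (2 * forks x) + suc (2 * forks y)
      ≡⟨ arith (forks x) (forks y) ⟩
    2 * suc (forks x + forks y) ∎)
    where
      open ≡-Reasoning
      arith : ∀ p q → suc (2 * p) + suc (2 * q) ≡ 2 * suc (p + q)
      arith = solve-∀

  tips-insertion : ∀ {b t u} → u ∈ insertions b t → tips u ↭ b ∷ tips t
  tips-insertion u∈ with insertion-view u∈
  ... | at-root = ↭-refl
  ... | in-left {y = y} x′∈ = ++⁺ʳ (tips y) (tips-insertion x′∈)
  ... | in-right {x} {y} y′∈ = ↭-trans (++⁺ʳ (tips x) (tips-insertion y′∈)) (prep _ (++-comm (tips y) (tips x)))

  forks-insertion : ∀ {b t u} → u ∈ insertions b t → forks u ≡ suc (forks t)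
  forks-insertion u∈ with insertion-view u∈
  ... | at-root = refl
  ... | in-left {y = y} x′∈ = cong (λ m → suc (m + forks y)) (forks-insertion x′∈)
  ... | in-right {x} {y} y′∈ = cong suc (trans (cong (_+ forks x) (forks-insertion y′∈)) (cong suc (+-comm (forks y) (forks x))))

  ∈-binTrees⁻ : ∀ {b c bs u} → u ∈ binTrees (b ∷ c ∷ bs) → Σ (BinTree X) λ t → t ∈ binTrees (c ∷ bs) × u ∈ insertions b t
  ∈-binTrees⁻ {b} {c} {bs} u∈ = find (∈-concatMap⁻ (insertions b) {xs = binTrees (c ∷ bs)} u∈)

  ∈-binTrees⁺ : ∀ {b c bs u t} → t ∈ binTrees (c ∷ bs) → u ∈ insertions b t → u ∈ binTrees (b ∷ c ∷ bs)
  ∈-binTrees⁺ {b} t∈ u∈ = ∈-concatMap⁺ (insertions b) (lose t∈ u∈)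

  tips-binTrees : ∀ {bs t} → t ∈ binTrees bs → tips t ↭ bs
  tips-binTrees {b ∷ []} (here refl) = ↭-refl
  tips-binTrees {b ∷ c ∷ bs} u∈ =
    let (t , t∈ , u∈ins) = ∈-binTrees⁻ {b} {c} {bs} u∈ in
    ↭-trans (tips-insertion u∈ins) (prep b (tips-binTrees {c ∷ bs} t∈))

  forks-binTrees : ∀ {bs t} → t ∈ binTrees bs → suc (forks t) ≡ length bs
  forks-binTrees {b ∷ []} (here refl) = refl
  forks-binTrees {b ∷ c ∷ bs} u∈ =
    let (t , t∈ , u∈ins) = ∈-binTrees⁻ {b} {c} {bs} u∈ in
    cong suc (trans (forks-insertion u∈ins) (forks-binTrees {c ∷ bs} t∈))

  insertion-is-fork : ∀ {b t u} → u ∈ insertions b t → Σ (BinTree X) λ x → Σ (BinTree X) λ y → u ≡ fork x y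
  insertion-is-fork u∈ with insertion-view u∈
  ... | at-root = _ , _ , refl
  ... | in-left _ = _ , _ , refl
  ... | in-right _ = _ , _ , refl

  binTrees-fork : ∀ {b c bs u} → u ∈ binTrees (b ∷ c ∷ bs) → Σ (BinTree X) λ x → Σ (BinTree X) λ y → u ≡ fork x y
  binTrees-fork {b} {c} {bs} u∈ = insertion-is-fork (proj₂ (proj₂ (∈-binTrees⁻ {b} {c} {bs} u∈)))

  length-binTrees : ∀ m (bs : List X) → length bs ≡ suc m → length (binTrees bs) ≡ (2 * suc m ∸ 3) !!
  length-binTrees zero (b ∷ []) _ = refl
  length-binTrees (suc m) (b ∷ c ∷ bs) |bs|≡ = begin
    length (concatMap (insertions b) (binTrees (c ∷ bs)))
      ≡⟨ length-concatMap-const (insertions b) (suc (2 * m)) (binTrees (c ∷ bs)) length-insertions-m ⟩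
    length (binTrees (c ∷ bs)) * suc (2 * m)
      ≡⟨ cong (_* suc (2 * m)) (length-binTrees m (c ∷ bs) (suc-injective |bs|≡)) ⟩
    (2 * suc m ∸ 3) !! * suc (2 * m)
      ≡⟨ !!-step m ⟩
    (2 * suc (suc m) ∸ 3) !! ∎
    where
      open ≡-Reasoning
      length-insertions-m : ∀ {t} → t ∈ binTrees (c ∷ bs) → length (insertions b t) ≡ suc (2 * m)
      length-insertions-m {t} t∈ =
        trans (length-insertions b t) (cong (λ k → suc (2 * k)) (suc-injective (trans (forks-binTrees {c ∷ bs} t∈) (suc-injective |bs|≡))))
      !!-step : ∀ m → (2 * suc m ∸ 3) !! * suc (2 * m) ≡ (2 * suc (suc m) ∸ 3) !!
      !!-step zero = refl
      !!-step (suc k) = begin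
        (2 * suc (suc k) ∸ 3) !! * suc (2 * suc k)  ≡⟨ cong₂ (λ a b → a !! * suc b) (2[2+k]∸3 k) (*-suc 2 k) ⟩
        suc (2 * k) !! * suc (suc (suc (2 * k)))    ≡⟨ *-comm (suc (2 * k) !!) _ ⟩
        suc (suc (suc (2 * k))) !!                  ≡⟨ cong (λ j → suc j !!) (sym (*-suc 2 k)) ⟩
        suc (2 * suc k) !!                          ≡⟨ cong _!! (sym (2[2+k]∸3 (suc k))) ⟩
        (2 * suc (suc (suc k)) ∸ 3) !!              ∎
        where
          2[2+k]∸3 : ∀ k → 2 * suc (suc k) ∸ 3 ≡ suc (2 * k)
          2[2+k]∸3 k = cong (_∸ 3) (trans (*-suc 2 (suc k)) (cong (λ j → suc (suc j)) (*-suc 2 k)))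
  length-binTrees zero (b ∷ c ∷ bs) ()
  length-binTrees (suc m) (b ∷ []) ()

  -- Binary trees are unordered; they are represented with the children of each fork sorted by least key.
  module Keyed (κ : X → ℕ) where

    minKey : BinTree X → ℕ
    minKey (tip a) = κ a
    minKey (fork x y) = minKey x

    Sorted : BinTree X → Set
    Sorted (tip _) = ⊤
    Sorted (fork x y) = minKey x < minKey y × Sorted x × Sorted y

    minKey-∈ : ∀ t → Σ X λ e → e ∈ tips t × minKey t ≡ κ e
    minKey-∈ (tip a) = a , here refl , refl
    minKey-∈ (fork x y) = let (e , e∈ , ≡κe) = minKey-∈ x in e , ∈-++⁺ˡ e∈ , ≡κe

    below-minKey : ∀ {b} t → (∀ {e} → e ∈ tips t → κ b < κ e) → κ b < minKey t
    below-minKey t b< = let (e , e∈ , ≡κe) = minKey-∈ t in subst (_ <_) (sym ≡κe) (b< e∈)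

    insertion-sorted : ∀ {b t u} → (∀ {e} → e ∈ tips t → κ b < κ e) → Sorted t → u ∈ insertions b t →
      minKey u ≡ κ b × Sorted u
    insertion-sorted {t = t} b< st u∈ with insertion-view u∈
    ... | at-root = refl , below-minKey t b< , tt , st
    ... | in-left {x} {y} x′∈ =
      let (≡κb , sx′) = insertion-sorted (b< ∘ ∈-++⁺ˡ) (proj₁ (proj₂ st)) x′∈ in
      ≡κb , subst (_< minKey y) (sym ≡κb) (below-minKey y (b< ∘ ∈-++⁺ʳ (tips x))) , sx′ , proj₂ (proj₂ st)
    ... | in-right {x} {y} y′∈ =
      let (≡κb , sy′) = insertion-sorted (b< ∘ ∈-++⁺ʳ (tips x)) (proj₂ (proj₂ st)) y′∈ in
      ≡κb , subst (_< minKey x) (sym ≡κb) (below-minKey x (b< ∘ ∈-++⁺ˡ)) , sy′ , proj₁ (proj₂ st)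

    binTrees-sorted : ∀ {b bs t} → AllPairs (λ p q → κ p < κ q) (b ∷ bs) → t ∈ binTrees (b ∷ bs) →
      minKey t ≡ κ b × Sorted t
    binTrees-sorted {bs = []} _ (here refl) = refl , tt
    binTrees-sorted {b} {c ∷ bs} (b< ∷ sorted) u∈ =
      let (t , t∈ , u∈ins) = ∈-binTrees⁻ {b} {c} {bs} u∈ in
      insertion-sorted (All.lookup b< ∘ ∈-resp-↭ (tips-binTrees t∈)) (proj₂ (binTrees-sorted sorted t∈)) u∈ins

    insertions-disjoint : ∀ {b t t′ u} → Sorted t → Sorted t′ → u ∈ insertions b t → u ∈ insertions b t′ → t ≡ t′
    insertions-disjoint st st′ u∈ u∈′ with insertion-view u∈ | insertion-view u∈′
    ... | at-root | at-root = refl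
    ... | at-root | in-left x′∈ = ⊥-elim (tip∉insertions x′∈)
    ... | at-root | in-right y′∈ = ⊥-elim (tip∉insertions y′∈)
    ... | in-left x′∈ | at-root = ⊥-elim (tip∉insertions x′∈)
    ... | in-right y′∈ | at-root = ⊥-elim (tip∉insertions y′∈)
    ... | in-left x′∈ | in-left x′∈′
      rewrite insertions-disjoint (proj₁ (proj₂ st)) (proj₁ (proj₂ st′)) x′∈ x′∈′ = refl
    ... | in-right y′∈ | in-right y′∈′
      rewrite insertions-disjoint (proj₂ (proj₂ st)) (proj₂ (proj₂ st′)) y′∈ y′∈′ = refl
    ... | in-left x′∈ | in-right y′∈′
      with refl ← insertions-disjoint (proj₁ (proj₂ st)) (proj₂ (proj₂ st′)) x′∈ y′∈′ =
      ⊥-elim (<-asym (proj₁ st) (proj₁ st′))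
    ... | in-right y′∈ | in-left x′∈′
      with refl ← insertions-disjoint (proj₂ (proj₂ st)) (proj₁ (proj₂ st′)) y′∈ x′∈′ =
      ⊥-elim (<-asym (proj₁ st) (proj₁ st′))

    Unique-insertions : ∀ {b t} → Sorted t → Unique (insertions b t)
    Unique-insertions {t = tip _} _ = [] ∷ []
    Unique-insertions {b} {fork x y} (x<y , sx , sy) =
      All.tabulate root∉below
      ∷ UniqueP.++⁺ (UniqueP.map⁺ fork-injectiveˡ (Unique-insertions sx)) (UniqueP.map⁺ fork-injectiveˡ (Unique-insertions sy)) left∩right
      where
        root∉below : ∀ {u} → u ∈ insertionsBelow b (fork x y) → fork (tip b) (fork x y) ≢ u
        root∉below u∈ e with ∈-++⁻ (map (λ x′ → fork x′ y) (insertions b x)) u∈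
        ... | inj₁ u∈ˡ with _ , _ , refl ← ∈-map⁻ (λ x′ → fork x′ y) u∈ˡ with () ← e
        ... | inj₂ u∈ʳ with _ , _ , refl ← ∈-map⁻ (λ y′ → fork y′ x) u∈ʳ with () ← e
        fork-injectiveˡ : ∀ {z u v} → fork u z ≡ fork v z → u ≡ v
        fork-injectiveˡ refl = refl
        left∩right : ∀ {u} → ¬ (u ∈ map (λ x′ → fork x′ y) (insertions b x) × u ∈ map (λ y′ → fork y′ x) (insertions b y))
        left∩right (u∈ˡ , u∈ʳ) with ∈-map⁻ (λ x′ → fork x′ y) u∈ˡ | ∈-map⁻ (λ y′ → fork y′ x) u∈ʳ
        ... | _ , _ , refl | _ , _ , refl = <-irrefl refl x<y

    Unique-binTrees : ∀ {bs} → AllPairs (λ p q → κ p < κ q) bs → Unique (binTrees bs)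
    Unique-binTrees {[]} _ = []
    Unique-binTrees {b ∷ []} _ = [] ∷ []
    Unique-binTrees {b ∷ c ∷ bs} (_ ∷ sorted) = Unique-concatMap⁺ (insertions b) (Unique-binTrees sorted)
      (λ t∈ → Unique-insertions (proj₂ (binTrees-sorted sorted t∈)))
      (λ t∈ t′∈ → insertions-disjoint (proj₂ (binTrees-sorted sorted t∈)) (proj₂ (binTrees-sorted sorted t′∈)))

  Interleaving-[]ˡ : ∀ {ys es : List X} → Interleaving [] ys es → es ≡ ys
  Interleaving-[]ˡ [] = refl
  Interleaving-[]ˡ (consʳ i) = cong (_ ∷_) (Interleaving-[]ˡ i)

  fork-∈-binTrees : ∀ {e es xs ys bx by} → Interleaving xs ys es →
    bx ∈ binTrees (e ∷ xs) → by ∈ binTrees ys → fork bx by ∈ binTrees (e ∷ es)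
  fork-∈-binTrees {e} {xs = []} {ys = c ∷ ys} i (here refl) by∈ with refl ← Interleaving-[]ˡ i =
    ∈-binTrees⁺ {e} {c} {ys} by∈ (here refl)
  fork-∈-binTrees {xs = []} {ys = []} _ _ ()
  fork-∈-binTrees {e} {c ∷ es} {_ ∷ xs} (consˡ i) bx∈ by∈ =
    let (bx₀ , bx₀∈ , bx∈ins) = ∈-binTrees⁻ {e} {c} {xs} bx∈ in
    ∈-binTrees⁺ {e} {c} {es} (fork-∈-binTrees i bx₀∈ by∈) (∈-insertions-left bx∈ins)
  fork-∈-binTrees {e} {c ∷ es} {x ∷ xs} {_ ∷ ys} (consʳ i) bx∈ by∈ =
    let (bx₀ , bx₀∈ , bx∈ins) = ∈-binTrees⁻ {e} {x} {xs} bx∈ in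
    ∈-binTrees⁺ {e} {c} {es} (fork-∈-binTrees (Interleaving-swap i) by∈ bx₀∈) (∈-insertions-right bx∈ins)

-- Leaves and adjacency of substitution trees

module _ {n : ℕ} where

  -- minLeaf t is minLabel (leaves t); n stands for +∞ on the empty list.
  minLabel : List (Fin n) → ℕ
  minLabel = foldr _⊓_ n ∘ map toℕ

  minLabel≤n : ∀ as → minLabel as ≤ n
  minLabel≤n [] = ≤-refl
  minLabel≤n (a ∷ as) = ≤-trans (m⊓n≤n (toℕ a) (minLabel as)) (minLabel≤n as)

  minLabel≤ : ∀ {as a} → a ∈ as → minLabel as ≤ toℕ a
  minLabel≤ {b ∷ as} (here refl) = m⊓n≤m (toℕ b) (minLabel as)
  minLabel≤ {b ∷ as} (there a∈) = ≤-trans (m⊓n≤n (toℕ b) (minLabel as)) (minLabel≤ a∈)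

  minLabel-sel : ∀ as → minLabel as ≡ n ⊎ Σ (Fin n) λ a → a ∈ as × minLabel as ≡ toℕ a
  minLabel-sel as with foldr-selective ⊓-sel n (map toℕ as)
  ... | inj₁ ≡n = inj₁ ≡n
  ... | inj₂ ∈as = let (a , a∈ , ≡a) = ∈-map⁻ toℕ ∈as in inj₂ (a , a∈ , ≡a)

  minLabel-∈ : ∀ {as a₀} → a₀ ∈ as → Σ (Fin n) λ a → a ∈ as × minLabel as ≡ toℕ a
  minLabel-∈ {as} {a₀} a₀∈ with minLabel-sel as
  ... | inj₂ attained = attained
  ... | inj₁ ≡n = ⊥-elim (<-irrefl refl (≤-<-trans (subst (_≤ toℕ a₀) ≡n (minLabel≤ a₀∈)) (toℕ<n a₀)))

  minLabel-mono : ∀ {as bs} → (∀ {a} → a ∈ bs → a ∈ as) → minLabel as ≤ minLabel bs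
  minLabel-mono {as} {bs} bs⊆as with minLabel-sel bs
  ... | inj₁ ≡n = subst (minLabel as ≤_) (sym ≡n) (minLabel≤n as)
  ... | inj₂ (a , a∈ , ≡a) = subst (minLabel as ≤_) (sym ≡a) (minLabel≤ (bs⊆as a∈))

  minLabel-cong : ∀ {as bs} → (∀ {a} → a ∈ as → a ∈ bs) → (∀ {a} → a ∈ bs → a ∈ as) → minLabel as ≡ minLabel bs
  minLabel-cong as⊆bs bs⊆as = ≤-antisym (minLabel-mono bs⊆as) (minLabel-mono as⊆bs)

  minLabel-++ : ∀ as bs → minLabel (as ++ bs) ≡ minLabel as ⊓ minLabel bs
  minLabel-++ [] bs = sym (m≥n⇒m⊓n≡n (minLabel≤n bs))
  minLabel-++ (a ∷ as) bs = trans (cong (toℕ a ⊓_) (minLabel-++ as bs)) (sym (⊓-assoc (toℕ a) (minLabel as) (minLabel bs)))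

  Linked-minLeaf⇒sorted : ∀ {cs : List (Tree n)} → Linked _<_ (map minLeaf cs) → AllPairs (λ a b → minLeaf a < minLeaf b) cs
  Linked-minLeaf⇒sorted = AllPairsP.map⁻ ∘ Linked⇒AllPairs <-trans

  minLeaf-resp-↭ : ∀ (t u : Tree n) → leaves t ↭ leaves u → minLeaf t ≡ minLeaf u
  minLeaf-resp-↭ t u p = minLabel-cong (∈-resp-↭ p) (∈-resp-↭ (↭-sym p))

  memT-true : (t : Tree n) {a : Fin n} → a ∈ leaves t → memT t a ≡ true
  memT-true t {a} = dec-true (any? (a ≟_) (leaves t))

  memT-false : (t : Tree n) {a : Fin n} → a ∉ leaves t → memT t a ≡ false
  memT-false t {a} = dec-false (any? (a ≟_) (leaves t))

  memT-true⁻ : (t : Tree n) {a : Fin n} → memT t a ≡ true → a ∈ leaves t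
  memT-true⁻ t {a} _ with yes a∈ ← any? (a ≟_) (leaves t) = a∈

  memT-false⁻ : (t : Tree n) {a : Fin n} → memT t a ≡ false → a ∉ leaves t
  memT-false⁻ t ≡false a∈ with () ← trans (sym ≡false) (memT-true t a∈)

  memL-true : (ts : List (Tree n)) {a : Fin n} → a ∈ leavesL ts → memL ts a ≡ true
  memL-true ts {a} = dec-true (any? (a ≟_) (leavesL ts))

  ∈-leaves-dec : (t : Tree n) (a : Fin n) → a ∈ leaves t ⊎ a ∉ leaves t
  ∈-leaves-dec t a with memT t a in e
  ... | true = inj₁ (memT-true⁻ t e)
  ... | false = inj₂ (memT-false⁻ t e)

  ∈-leavesL⁻ : ∀ {cs : List (Tree n)} {a} → a ∈ leavesL cs → Σ (Tree n) λ c → c ∈ cs × a ∈ leaves c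
  ∈-leavesL⁻ {c ∷ cs} a∈ with ∈-++⁻ (leaves c) a∈
  ... | inj₁ a∈c = c , here refl , a∈c
  ... | inj₂ a∈cs = let (d , d∈ , a∈d) = ∈-leavesL⁻ a∈cs in d , there d∈ , a∈d

  ∈-leavesL⁺ : ∀ {cs : List (Tree n)} {a c} → c ∈ cs → a ∈ leaves c → a ∈ leavesL cs
  ∈-leavesL⁺ {c ∷ cs} (here refl) a∈ = ∈-++⁺ˡ a∈
  ∈-leavesL⁺ {d ∷ cs} (there c∈) a∈ = ∈-++⁺ʳ (leaves d) (∈-leavesL⁺ c∈ a∈)

  ∈-leavesV⁻ : ∀ {k} {ts : Vec (Tree n) k} {a} → a ∈ leavesV ts → Σ (Fin k) λ i → a ∈ leaves (lookup ts i)
  ∈-leavesV⁻ {ts = t ∷ ts} a∈ with ∈-++⁻ (leaves t) a∈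
  ... | inj₁ a∈t = zero , a∈t
  ... | inj₂ a∈ts = let (i , a∈i) = ∈-leavesV⁻ {ts = ts} a∈ts in suc i , a∈i

  ∈-leavesV⁺ : ∀ {k} {ts : Vec (Tree n) k} {a} (i : Fin k) → a ∈ leaves (lookup ts i) → a ∈ leavesV ts
  ∈-leavesV⁺ {ts = t ∷ ts} zero a∈ = ∈-++⁺ˡ a∈
  ∈-leavesV⁺ {ts = t ∷ ts} (suc i) a∈ = ∈-++⁺ʳ (leaves t) (∈-leavesV⁺ {ts = ts} i a∈)

  leavesL-++ : ∀ (xs ys : List (Tree n)) → leavesL (xs ++ ys) ≡ leavesL xs ++ leavesL ys
  leavesL-++ [] ys = refl
  leavesL-++ (x ∷ xs) ys = trans (cong (leaves x ++_) (leavesL-++ xs ys)) (sym (Listₚ.++-assoc (leaves x) (leavesL xs) (leavesL ys)))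

  leavesL-↭ : ∀ {xs ys : List (Tree n)} → xs ↭ ys → leavesL xs ↭ leavesL ys
  leavesL-↭ Perm.refl = ↭-refl
  leavesL-↭ (prep x p) = ++⁺ˡ (leaves x) (leavesL-↭ p)
  leavesL-↭ {x ∷ y ∷ xs} (swap _ _ p) =
    ↭-trans (↭-sym (++-assoc (leaves x) (leaves y) (leavesL xs)))
     (↭-trans (++⁺ʳ (leavesL xs) (++-comm (leaves x) (leaves y)))
      (↭-trans (++-assoc (leaves y) (leaves x) (leavesL xs))
       (++⁺ˡ (leaves y) (++⁺ˡ (leaves x) (leavesL-↭ p)))))
  leavesL-↭ (Perm.trans p q) = ↭-trans (leavesL-↭ p) (leavesL-↭ q)

  Unique-leavesL-child : ∀ {cs : List (Tree n)} {c} → Unique (leavesL cs) → c ∈ cs → Unique (leaves c)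
  Unique-leavesL-child {c ∷ cs} u (here refl) = Unique-++⁻ˡ u
  Unique-leavesL-child {d ∷ cs} u (there c∈) = Unique-leavesL-child (Unique-++⁻ʳ (leaves d) u) c∈

  Unique-leavesL-sameChild : ∀ {cs : List (Tree n)} {c d a} → Unique (leavesL cs) → c ∈ cs → d ∈ cs →
    a ∈ leaves c → a ∈ leaves d → c ≡ d
  Unique-leavesL-sameChild {c ∷ cs} u (here refl) (here refl) _ _ = refl
  Unique-leavesL-sameChild {c ∷ cs} u (here refl) (there d∈) a∈c a∈d = ⊥-elim (Unique-++⇒disjoint u a∈c (∈-leavesL⁺ d∈ a∈d))
  Unique-leavesL-sameChild {c ∷ cs} u (there c∈) (here refl) a∈c a∈d = ⊥-elim (Unique-++⇒disjoint u a∈d (∈-leavesL⁺ c∈ a∈c))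
  Unique-leavesL-sameChild {c ∷ cs} u (there c∈) (there d∈) = Unique-leavesL-sameChild (Unique-++⁻ʳ (leaves c) u) c∈ d∈

  Unique-leavesV-child : ∀ {k} {ts : Vec (Tree n) k} → Unique (leavesV ts) → (i : Fin k) → Unique (leaves (lookup ts i))
  Unique-leavesV-child {ts = t ∷ ts} u zero = Unique-++⁻ˡ u
  Unique-leavesV-child {ts = t ∷ ts} u (suc i) = Unique-leavesV-child {ts = ts} (Unique-++⁻ʳ (leaves t) u) i

  Unique-leavesV-sameIndex : ∀ {k} {ts : Vec (Tree n) k} → Unique (leavesV ts) → (i j : Fin k) →
    ∀ {a} → a ∈ leaves (lookup ts i) → a ∈ leaves (lookup ts j) → i ≡ j
  Unique-leavesV-sameIndex {ts = t ∷ ts} u zero zero _ _ = refl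
  Unique-leavesV-sameIndex {ts = t ∷ ts} u zero (suc j) a∈i a∈j = ⊥-elim (Unique-++⇒disjoint u a∈i (∈-leavesV⁺ {ts = ts} j a∈j))
  Unique-leavesV-sameIndex {ts = t ∷ ts} u (suc i) zero a∈i a∈j = ⊥-elim (Unique-++⇒disjoint u a∈j (∈-leavesV⁺ {ts = ts} i a∈i))
  Unique-leavesV-sameIndex {ts = t ∷ ts} u (suc i) (suc j) a∈i a∈j =
    cong suc (Unique-leavesV-sameIndex {ts = ts} (Unique-++⁻ʳ (leaves t) u) i j a∈i a∈j)

  EveryL-∈ : ∀ {P : Tree n → Set} {cs c} → EveryL P cs → c ∈ cs → Every P c
  EveryL-∈ {cs = c ∷ cs} (p , _) (here refl) = p
  EveryL-∈ {cs = d ∷ cs} (_ , ps) (there c∈) = EveryL-∈ ps c∈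

  EveryV-lookup : ∀ {P : Tree n → Set} {k} {ts : Vec (Tree n) k} → EveryV P ts → (i : Fin k) → Every P (lookup ts i)
  EveryV-lookup {ts = t ∷ ts} (p , _) zero = p
  EveryV-lookup {ts = t ∷ ts} (_ , ps) (suc i) = EveryV-lookup {ts = ts} ps i

  leaves-nonempty : (t : Tree n) → Every WFLocal t → Σ (Fin n) λ a → a ∈ leaves t
  leaves-nonempty (leaf a) _ = a , here refl
  leaves-nonempty (lin s (c ∷ cs)) (_ , wf , _) = let (a , a∈) = leaves-nonempty c wf in a , ∈-++⁺ˡ a∈
  leaves-nonempty (gnode (suc k) H (t ∷ ts)) (_ , wf , _) = let (a , a∈) = leaves-nonempty t wf in a , ∈-++⁺ˡ a∈
  leaves-nonempty (lin s []) ((() , _) , _)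
  leaves-nonempty (gnode zero H []) ((() , _) , _)

  length-leaves-lookup≤ : ∀ {k} (ts : Vec (Tree n) k) i → length (leaves (lookup ts i)) ≤ length (leavesV ts)
  length-leaves-lookup≤ (t ∷ ts) zero rewrite length-++ (leaves t) {leavesV ts} = m≤m+n _ _
  length-leaves-lookup≤ (t ∷ ts) (suc i) rewrite length-++ (leaves t) {leavesV ts} = ≤-trans (length-leaves-lookup≤ ts i) (m≤n+m _ _)

  length-leaves-lookup< : ∀ {k} (ts : Vec (Tree n) k) → (∀ j → Σ (Fin n) λ a → a ∈ leaves (lookup ts j)) → 2 ≤ k → ∀ i →
    length (leaves (lookup ts i)) < length (leavesV ts)
  length-leaves-lookup< (t ∷ t₁ ∷ ts) nonempty _ zero
    rewrite length-++ (leaves t) {leavesV (t₁ ∷ ts)} | length-++ (leaves t₁) {leavesV ts} =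
    subst (_≤ length (leaves t) + (length (leaves t₁) + length (leavesV ts))) (+-comm (length (leaves t)) 1)
      (+-monoʳ-≤ (length (leaves t)) (≤-trans (∈-length (proj₂ (nonempty (suc zero)))) (m≤m+n _ _)))
  length-leaves-lookup< (t ∷ []) _ (s≤s ()) zero
  length-leaves-lookup< (t ∷ ts) nonempty _ (suc i) rewrite length-++ (leaves t) {leavesV ts} =
    ≤-trans (s≤s (length-leaves-lookup≤ ts i)) (+-monoˡ-≤ (length (leavesV ts)) (∈-length (proj₂ (nonempty zero))))

  adjAtV-lookup : ∀ {k} (ts : Vec (Tree n) k) (i : Fin k) (a b : Fin n) → adjAtV ts i a b ≡ adj (lookup ts i) a b
  adjAtV-lookup (t ∷ ts) zero a b = refl
  adjAtV-lookup (t ∷ ts) (suc i) a b = adjAtV-lookup ts i a b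

  posV-∈ : ∀ {k} (ts : Vec (Tree n) k) → Unique (leavesV ts) → ∀ {a} (i : Fin k) → a ∈ leaves (lookup ts i) → posV ts a ≡ just i
  posV-∈ (t ∷ ts) u zero a∈ rewrite memT-true t a∈ = refl
  posV-∈ (t ∷ ts) u (suc i) a∈ rewrite memT-false t (λ a∈t → Unique-++⇒disjoint u a∈t (∈-leavesV⁺ {ts = ts} i a∈))
    | posV-∈ ts (Unique-++⁻ʳ (leaves t) u) i a∈ = refl

  adj-gnode-inside : ∀ {k} (H : Mat k) (ts : Vec (Tree n) k) → Unique (leavesV ts) → ∀ {a b} (i : Fin k) →
    a ∈ leaves (lookup ts i) → b ∈ leaves (lookup ts i) → adj (gnode k H ts) a b ≡ adj (lookup ts i) a b
  adj-gnode-inside H ts u {a} {b} i a∈ b∈ rewrite posV-∈ ts u i a∈ | posV-∈ ts u i b∈ | dec-true (i ≟ i) refl =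
    adjAtV-lookup ts i a b

  adj-gnode-across : ∀ {k} (H : Mat k) (ts : Vec (Tree n) k) → Unique (leavesV ts) → ∀ {a b} (i j : Fin k) → i ≢ j →
    a ∈ leaves (lookup ts i) → b ∈ leaves (lookup ts j) → adj (gnode k H ts) a b ≡ matAdj H i j
  adj-gnode-across H ts u i j i≢j a∈ b∈ rewrite posV-∈ ts u i a∈ | posV-∈ ts u j b∈ | dec-false (i ≟ j) i≢j = refl

  adjLin-inside : (s : Bool) (cs : List (Tree n)) → Unique (leavesL cs) → ∀ {c a b} → c ∈ cs →
    a ∈ leaves c → b ∈ leaves c → adjLin s cs a b ≡ adj c a b
  adjLin-inside s (c ∷ cs) u (here refl) a∈ b∈ rewrite memT-true c a∈ | memT-true c b∈ = refl
  adjLin-inside s (d ∷ cs) u (there c∈) a∈ b∈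
    rewrite memT-false d (λ a∈d → Unique-++⇒disjoint u a∈d (∈-leavesL⁺ c∈ a∈))
          | memT-false d (λ b∈d → Unique-++⇒disjoint u b∈d (∈-leavesL⁺ c∈ b∈)) =
    adjLin-inside s cs (Unique-++⁻ʳ (leaves d) u) c∈ a∈ b∈

  adjLin-across : (s : Bool) (cs : List (Tree n)) → Unique (leavesL cs) → ∀ {c a b} → c ∈ cs →
    a ∈ leaves c → b ∈ leavesL cs → b ∉ leaves c → adjLin s cs a b ≡ s
  adjLin-across s (c ∷ cs) u (here refl) a∈ b∈ b∉ with ∈-++⁻ (leaves c) b∈
  ... | inj₁ b∈c = ⊥-elim (b∉ b∈c)
  ... | inj₂ b∈cs rewrite memT-true c a∈ | memT-false c b∉ | memL-true cs b∈cs = refl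
  adjLin-across s (d ∷ cs) u (there c∈) a∈ b∈ b∉
    rewrite memT-false d (λ a∈d → Unique-++⇒disjoint u a∈d (∈-leavesL⁺ c∈ a∈)) with ∈-++⁻ (leaves d) b∈
  ... | inj₁ b∈d rewrite memT-true d b∈d | memL-true cs (∈-leavesL⁺ c∈ a∈) = refl
  ... | inj₂ b∈cs rewrite memT-false d (λ b∈d → Unique-++⇒disjoint u b∈d b∈cs) =
    adjLin-across s cs (Unique-++⁻ʳ (leaves d) u) c∈ a∈ b∈cs b∉

-- Expansions and their number

bracketings : ℕ → ℕ
bracketings d = (2 * d ∸ 3) !!

product-map-++ : ∀ (f : ℕ → ℕ) xs ys → product (map f (xs ++ ys)) ≡ product (map f xs) * product (map f ys)
product-map-++ f xs ys = trans (cong product (map-++ f xs ys)) (product-++ (map f xs) (map f ys))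

module _ {n : ℕ} where

  nestLin : Bool → BinTree (Tree n) → Tree n
  nestLin s (tip t) = t
  nestLin s (fork x y) = lin s (nestLin s x ∷ nestLin s y ∷ [])

  mutual
    expansions : Tree n → List (Tree n)
    expansions (leaf a) = leaf a ∷ []
    expansions (lin s cs) = concatMap (map (nestLin s) ∘ binTrees) (expansionsL cs)
    expansions (gnode k H ts) = map (gnode k H) (expansionsV ts)

    expansionsL : List (Tree n) → List (List (Tree n))
    expansionsL [] = [] ∷ []
    expansionsL (c ∷ cs) = concatMap (λ e → map (e ∷_) (expansionsL cs)) (expansions c)

    expansionsV : ∀ {k} → Vec (Tree n) k → List (Vec (Tree n) k)
    expansionsV [] = [] ∷ []
    expansionsV (t ∷ ts) = concatMap (λ e → map (e ∷_) (expansionsV ts)) (expansions t)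

  _Expands_ : Tree n → Tree n → Set
  e Expands c = e ∈ expansions c

  ∈-expansionsL⁻ : ∀ {cs es} → es ∈ expansionsL cs → Pointwise _Expands_ es cs
  ∈-expansionsL⁻ {[]} (here refl) = []
  ∈-expansionsL⁻ {c ∷ cs} es∈
    with e , e∈ , es∈′ ← find (∈-concatMap⁻ (λ e → map (e ∷_) (expansionsL cs)) {xs = expansions c} es∈)
    with _ , es′∈ , refl ← ∈-map⁻ (e ∷_) es∈′ = e∈ ∷ ∈-expansionsL⁻ es′∈

  ∈-expansionsL⁺ : ∀ {cs es} → Pointwise _Expands_ es cs → es ∈ expansionsL cs
  ∈-expansionsL⁺ [] = here refl
  ∈-expansionsL⁺ {c ∷ cs} {e ∷ es} (e∈ ∷ es∈) =
    ∈-concatMap⁺ (λ e → map (e ∷_) (expansionsL cs)) (lose e∈ (∈-map⁺ (e ∷_) (∈-expansionsL⁺ es∈)))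

  ∈-expansionsV⁻ : ∀ {k} {ts es : Vec (Tree n) k} → es ∈ expansionsV ts → Pointwiseᵥ.Pointwise _Expands_ es ts
  ∈-expansionsV⁻ {ts = []} {[]} (here refl) = []
  ∈-expansionsV⁻ {ts = t ∷ ts} es∈
    with e , e∈ , es∈′ ← find (∈-concatMap⁻ (λ e → map (e ∷_) (expansionsV ts)) {xs = expansions t} es∈)
    with _ , es′∈ , refl ← ∈-map⁻ (e ∷_) es∈′ = e∈ ∷ ∈-expansionsV⁻ es′∈

  ∈-expansionsV⁺ : ∀ {k} {ts es : Vec (Tree n) k} → Pointwiseᵥ.Pointwise _Expands_ es ts → es ∈ expansionsV ts
  ∈-expansionsV⁺ [] = here refl
  ∈-expansionsV⁺ {ts = t ∷ ts} {e ∷ es} (e∈ ∷ es∈) =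
    ∈-concatMap⁺ (λ e → map (e ∷_) (expansionsV ts)) (lose e∈ (∈-map⁺ (e ∷_) (∈-expansionsV⁺ es∈)))

  mutual
    length-expansions : ∀ t → Every WFLocal t → length (expansions t) ≡ product (map bracketings (linDegrees t))
    length-expansions (leaf a) _ = refl
    length-expansions (lin s []) ((() , _) , _)
    length-expansions (lin s (c ∷ cs)) (_ , wf) = begin
      length (concatMap (map (nestLin s) ∘ binTrees) (expansionsL (c ∷ cs)))
        ≡⟨ length-concatMap-const (map (nestLin s) ∘ binTrees) (bracketings d) (expansionsL (c ∷ cs)) length-bracketings ⟩
      length (expansionsL (c ∷ cs)) * bracketings d
        ≡⟨ cong (_* bracketings d) (length-expansionsL (c ∷ cs) wf) ⟩
      product (map bracketings (linDegreesL (c ∷ cs))) * bracketings d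
        ≡⟨ *-comm _ (bracketings d) ⟩
      bracketings d * product (map bracketings (linDegreesL (c ∷ cs))) ∎
      where
        open ≡-Reasoning
        d : ℕ
        d = suc (length cs)
        length-bracketings : ∀ {es} → es ∈ expansionsL (c ∷ cs) → length (map (nestLin s) (binTrees es)) ≡ bracketings d
        length-bracketings {es} es∈ =
          trans (length-map (nestLin s) (binTrees es)) (length-binTrees (length cs) es (Pointwise-length (∈-expansionsL⁻ {c ∷ cs} es∈)))
    length-expansions (gnode k H ts) (_ , wf) = trans (length-map (gnode k H) (expansionsV ts)) (length-expansionsV ts wf)

    length-expansionsL : ∀ cs → EveryL WFLocal cs → length (expansionsL cs) ≡ product (map bracketings (linDegreesL cs))
    length-expansionsL [] _ = refl
    length-expansionsL (c ∷ cs) (wf , wfs) = begin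
      length (concatMap (λ e → map (e ∷_) (expansionsL cs)) (expansions c))
        ≡⟨ length-concatMap-const (λ e → map (e ∷_) (expansionsL cs)) _ (expansions c) (λ _ → length-map _ (expansionsL cs)) ⟩
      length (expansions c) * length (expansionsL cs)
        ≡⟨ cong₂ _*_ (length-expansions c wf) (length-expansionsL cs wfs) ⟩
      product (map bracketings (linDegrees c)) * product (map bracketings (linDegreesL cs))
        ≡⟨ product-map-++ bracketings (linDegrees c) (linDegreesL cs) ⟨
      product (map bracketings (linDegrees c ++ linDegreesL cs)) ∎
      where open ≡-Reasoning

    length-expansionsV : ∀ {k} (ts : Vec (Tree n) k) → EveryV WFLocal ts →
      length (expansionsV ts) ≡ product (map bracketings (linDegreesV ts))
    length-expansionsV [] _ = refl
    length-expansionsV (t ∷ ts) (wf , wfs) = begin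
      length (concatMap (λ e → map (e ∷_) (expansionsV ts)) (expansions t))
        ≡⟨ length-concatMap-const (λ e → map (e ∷_) (expansionsV ts)) _ (expansions t) (λ _ → length-map _ (expansionsV ts)) ⟩
      length (expansions t) * length (expansionsV ts)
        ≡⟨ cong₂ _*_ (length-expansions t wf) (length-expansionsV ts wfs) ⟩
      product (map bracketings (linDegrees t)) * product (map bracketings (linDegreesV ts))
        ≡⟨ product-map-++ bracketings (linDegrees t) (linDegreesV ts) ⟨
      product (map bracketings (linDegrees t ++ linDegreesV ts)) ∎
      where open ≡-Reasoning

-- Expansions are expanded trees

excess : ℕ → ℕ
excess e = e ∸ 2

module _ {n : ℕ} where

  leaves-nestLin : ∀ s (bt : BinTree (Tree n)) → leaves (nestLin s bt) ↭ leavesL (tips bt)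
  leaves-nestLin s (tip t) = ↭-reflexive (sym (++-identityʳ (leaves t)))
  leaves-nestLin s (fork x y) = begin
    leaves (nestLin s x) ++ leaves (nestLin s y) ++ [] ≡⟨ cong (leaves (nestLin s x) ++_) (++-identityʳ _) ⟩
    leaves (nestLin s x) ++ leaves (nestLin s y)      ↭⟨ ++⁺ (leaves-nestLin s x) (leaves-nestLin s y) ⟩
    leavesL (tips x) ++ leavesL (tips y)              ≡⟨ leavesL-++ (tips x) (tips y) ⟨
    leavesL (tips x ++ tips y)                        ∎
    where open PermutationReasoning

  ∈-leaves-nestLin : ∀ s (bt : BinTree (Tree n)) {e a} → e ∈ tips bt → a ∈ leaves e → a ∈ leaves (nestLin s bt)
  ∈-leaves-nestLin s bt e∈ a∈ = ∈-resp-↭ (↭-sym (leaves-nestLin s bt)) (∈-leavesL⁺ e∈ a∈)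

  adj-nestLin-inside : ∀ s (bt : BinTree (Tree n)) → Unique (leaves (nestLin s bt)) → ∀ {e a b} → e ∈ tips bt →
    a ∈ leaves e → b ∈ leaves e → adj (nestLin s bt) a b ≡ adj e a b
  adj-nestLin-inside s (tip _) _ (here refl) _ _ = refl
  adj-nestLin-inside s (fork x y) u e∈ a∈ b∈ with ∈-++⁻ (tips x) e∈
  ... | inj₁ e∈x = trans (adjLin-inside s (nestLin s x ∷ nestLin s y ∷ []) u (here refl)
                                         (∈-leaves-nestLin s x e∈x a∈) (∈-leaves-nestLin s x e∈x b∈))
                         (adj-nestLin-inside s x (Unique-++⁻ˡ u) e∈x a∈ b∈)
  ... | inj₂ e∈y = trans (adjLin-inside s (nestLin s x ∷ nestLin s y ∷ []) u (there (here refl))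
                                         (∈-leaves-nestLin s y e∈y a∈) (∈-leaves-nestLin s y e∈y b∈))
                         (adj-nestLin-inside s y (Unique-++⁻ˡ (Unique-++⁻ʳ (leaves (nestLin s x)) u)) e∈y a∈ b∈)

  adj-nestLin-across : ∀ s (bt : BinTree (Tree n)) → Unique (leaves (nestLin s bt)) → ∀ {e a b} → e ∈ tips bt →
    a ∈ leaves e → b ∈ leaves (nestLin s bt) → b ∉ leaves e → adj (nestLin s bt) a b ≡ s
  adj-nestLin-across s (tip _) _ (here refl) _ b∈ b∉ = ⊥-elim (b∉ b∈)
  adj-nestLin-across s (fork x y) u {b = b} e∈ a∈ b∈ b∉ with ∈-++⁻ (tips x) e∈
  ... | inj₁ e∈x with ∈-leaves-dec (nestLin s x) b
  ...   | inj₁ b∈x = trans (adjLin-inside s (nestLin s x ∷ nestLin s y ∷ []) u (here refl) (∈-leaves-nestLin s x e∈x a∈) b∈x)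
                           (adj-nestLin-across s x (Unique-++⁻ˡ u) e∈x a∈ b∈x b∉)
  ...   | inj₂ b∉x = adjLin-across s (nestLin s x ∷ nestLin s y ∷ []) u (here refl) (∈-leaves-nestLin s x e∈x a∈) b∈ b∉x
  adj-nestLin-across s (fork x y) u {b = b} e∈ a∈ b∈ b∉ | inj₂ e∈y with ∈-leaves-dec (nestLin s y) b
  ...   | inj₁ b∈y = trans (adjLin-inside s (nestLin s x ∷ nestLin s y ∷ []) u (there (here refl)) (∈-leaves-nestLin s y e∈y a∈) b∈y)
                           (adj-nestLin-across s y (Unique-++⁻ˡ (Unique-++⁻ʳ (leaves (nestLin s x)) u)) e∈y a∈ b∈y b∉)
  ...   | inj₂ b∉y = adjLin-across s (nestLin s x ∷ nestLin s y ∷ []) u (there (here refl)) (∈-leaves-nestLin s y e∈y a∈) b∈ b∉y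

  module KM = Keyed (minLeaf {n})

  minLeaf-nestLin : ∀ s (bt : BinTree (Tree n)) → KM.Sorted bt → minLeaf (nestLin s bt) ≡ KM.minKey bt
  minLeaf-nestLin s (tip _) _ = refl
  minLeaf-nestLin s (fork x y) (x<y , sx , sy) = begin
    minLabel (leaves (nestLin s x) ++ leaves (nestLin s y) ++ [])
      ≡⟨ minLabel-++ (leaves (nestLin s x)) (leaves (nestLin s y) ++ []) ⟩
    minLeaf (nestLin s x) ⊓ minLabel (leaves (nestLin s y) ++ [])
      ≡⟨ cong (minLeaf (nestLin s x) ⊓_) (cong minLabel (++-identityʳ (leaves (nestLin s y)))) ⟩
    minLeaf (nestLin s x) ⊓ minLeaf (nestLin s y)
      ≡⟨ cong₂ _⊓_ (minLeaf-nestLin s x sx) (minLeaf-nestLin s y sy) ⟩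
    KM.minKey x ⊓ KM.minKey y
      ≡⟨ m≤n⇒m⊓n≡m (<⇒≤ x<y) ⟩
    KM.minKey x ∎
    where open ≡-Reasoning

  nestLin-wf : ∀ s (bt : BinTree (Tree n)) → KM.Sorted bt → (∀ {e} → e ∈ tips bt → Every WFLocal e) → Every WFLocal (nestLin s bt)
  nestLin-wf s (tip _) _ wf = wf (here refl)
  nestLin-wf s (fork x y) (x<y , sx , sy) wf =
    (s≤s (s≤s z≤n) , subst₂ _<_ (sym (minLeaf-nestLin s x sx)) (sym (minLeaf-nestLin s y sy)) x<y ∷ [-]) ,
    nestLin-wf s x sx (wf ∘ ∈-++⁺ˡ) , nestLin-wf s y sy (wf ∘ ∈-++⁺ʳ (tips x)) , tt

  Every-nestLin : ∀ {P : Tree n → Set} s → (∀ x y → P (lin s (x ∷ y ∷ []))) →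
    (bt : BinTree (Tree n)) → (∀ {e} → e ∈ tips bt → Every P e) → Every P (nestLin s bt)
  Every-nestLin s P-lin (tip _) P-tips = P-tips (here refl)
  Every-nestLin s P-lin (fork x y) P-tips =
    P-lin _ _ , Every-nestLin s P-lin x (P-tips ∘ ∈-++⁺ˡ) , Every-nestLin s P-lin y (P-tips ∘ ∈-++⁺ʳ (tips x)) , tt

  edges-nestLin : ∀ s (bt : BinTree (Tree n)) → edges (nestLin s bt) ≡ sum (map edges (tips bt)) + 2 * forks bt
  edges-nestLin s (tip _) = sym (trans (+-identityʳ _) (+-identityʳ _))
  edges-nestLin s (fork x y) rewrite edges-nestLin s x | edges-nestLin s y | map-++ edges (tips x) (tips y)
    | sum-++ (map edges (tips x)) (map edges (tips y)) = arith (sum (map edges (tips x))) (sum (map edges (tips y))) (forks x) (forks y)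
    where arith : ∀ a b p q → suc (a + 2 * p + suc (b + 2 * q + 0)) ≡ a + b + 2 * suc (p + q)
          arith = solve-∀

  nonlinExcess : Tree n → ℕ
  nonlinExcess t = sum (map excess (nonlinDegrees t))

  -- The edge count 2m - 2 - Σ (e_i - 2) is carried through the induction in subtraction-free form.
  record _IsExpansionOf_ (e τ : Tree n) : Set where
    field
      isWF : Every WFLocal e
      isPrime : Every PrimeLocal e
      isBinary : Every BinaryLocal e
      leaves↭ : leaves e ↭ leaves τ
      adj≡ : ∀ {a b} → a ∈ leaves τ → b ∈ leaves τ → adj e a b ≡ adj τ a b
      sign≡ : linSign e ≡ linSign τ
      edges≡ : edges e + nonlinExcess τ + 2 ≡ 2 * length (leaves τ)
  open _IsExpansionOf_ public

  leavesL-expansions : ∀ {es cs} → Pointwise _IsExpansionOf_ es cs → leavesL es ↭ leavesL cs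
  leavesL-expansions [] = ↭-refl
  leavesL-expansions (e ∷ es) = ++⁺ (leaves↭ e) (leavesL-expansions es)

  leavesV-expansions : ∀ {k} {es ts : Vec (Tree n) k} → Pointwiseᵥ.Pointwise _IsExpansionOf_ es ts → leavesV es ↭ leavesV ts
  leavesV-expansions [] = ↭-refl
  leavesV-expansions (e ∷ es) = ++⁺ (leaves↭ e) (leavesV-expansions es)

  minLeavesV-expansions : ∀ {k} {es ts : Vec (Tree n) k} → Pointwiseᵥ.Pointwise _IsExpansionOf_ es ts →
    map minLeaf (toList es) ≡ map minLeaf (toList ts)
  minLeavesV-expansions [] = refl
  minLeavesV-expansions {es = e ∷ _} {t ∷ _} (e≈ ∷ es≈) =
    cong₂ _∷_ (minLeaf-resp-↭ e t (leaves↭ e≈)) (minLeavesV-expansions es≈)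

  sorted-expansions : ∀ {es cs} → Pointwise _IsExpansionOf_ es cs →
    AllPairs (λ a b → minLeaf a < minLeaf b) cs → AllPairs (λ a b → minLeaf a < minLeaf b) es
  sorted-expansions es≈ = Pointwise-sorted minLeaf minLeaf (Pointwiseₗ.map (λ {e} {c} e≈ → minLeaf-resp-↭ e c (leaves↭ e≈)) es≈)

  EveryV-expansions : ∀ {k} {P : Tree n → Set} {es ts : Vec (Tree n) k} → Pointwiseᵥ.Pointwise _IsExpansionOf_ es ts →
    (∀ {e τ} → e IsExpansionOf τ → Every P e) → EveryV P es
  EveryV-expansions [] _ = tt
  EveryV-expansions (e≈ ∷ es≈) P-e = P-e e≈ , EveryV-expansions es≈ P-e

  edgesL-expansions : ∀ {es cs} → Pointwise _IsExpansionOf_ es cs →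
    sum (map edges es) + sum (map excess (nonlinDegreesL cs)) + 2 * length cs ≡ 2 * length (leavesL cs)
  edgesL-expansions [] = refl
  edgesL-expansions {e ∷ es} {c ∷ cs} (e≈ ∷ es≈)
    rewrite map-++ excess (nonlinDegrees c) (nonlinDegreesL cs) | sum-++ (map excess (nonlinDegrees c)) (map excess (nonlinDegreesL cs))
          | length-++ (leaves c) {leavesL cs} =
    trans (arith₁ (edges e) (sum (map edges es)) (nonlinExcess c) (sum (map excess (nonlinDegreesL cs))) (length cs))
      (trans (cong₂ _+_ (edges≡ e≈) (edgesL-expansions es≈)) (sym (*-distribˡ-+ 2 (length (leaves c)) (length (leavesL cs)))))
    where arith₁ : ∀ a b c d l → a + b + (c + d) + 2 * suc l ≡ (a + c + 2) + (b + d + 2 * l)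
          arith₁ = solve-∀

  edgesV-expansions : ∀ {k} {es ts : Vec (Tree n) k} → Pointwiseᵥ.Pointwise _IsExpansionOf_ es ts →
    edgesV es + sum (map excess (nonlinDegreesV ts)) + k ≡ 2 * length (leavesV ts)
  edgesV-expansions [] = refl
  edgesV-expansions {suc k} {e ∷ es} {t ∷ ts} (e≈ ∷ es≈)
    rewrite map-++ excess (nonlinDegrees t) (nonlinDegreesV ts) | sum-++ (map excess (nonlinDegrees t)) (map excess (nonlinDegreesV ts))
          | length-++ (leaves t) {leavesV ts} =
    trans (arith₁ (edges e) (edgesV es) (nonlinExcess t) (sum (map excess (nonlinDegreesV ts))) k)
      (trans (cong₂ _+_ (edges≡ e≈) (edgesV-expansions es≈)) (sym (*-distribˡ-+ 2 (length (leaves t)) (length (leavesV ts)))))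
    where arith₁ : ∀ a b c d l → suc a + b + (c + d) + suc l ≡ (a + c + 2) + (b + d + l)
          arith₁ = solve-∀

  expansion-gnode : ∀ {k} (H : Mat k) (ts es : Vec (Tree n) k) → WFLocal (gnode k H ts) → PrimeLocal (gnode k H ts) →
    Unique (leavesV ts) → Pointwiseᵥ.Pointwise _IsExpansionOf_ es ts → gnode k H es IsExpansionOf gnode k H ts
  expansion-gnode {k} H ts es (2≤k , H-graph , sorted) H-prime u es≈ = record
    { isWF = (2≤k , H-graph , subst (Linked _<_) (sym (minLeavesV-expansions es≈)) sorted) , EveryV-expansions es≈ isWF
    ; isPrime = H-prime , EveryV-expansions es≈ isPrime
    ; isBinary = tt , EveryV-expansions es≈ isBinary
    ; leaves↭ = leavesV-expansions es≈
    ; adj≡ = adj-≡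
    ; sign≡ = refl
    ; edges≡ = edges-≡ 2≤k
    }
    where
      u-es : Unique (leavesV es)
      u-es = Unique-resp-↭ (↭-sym (leavesV-expansions es≈)) u
      ∈-expansion : ∀ i {a} → a ∈ leaves (lookup ts i) → a ∈ leaves (lookup es i)
      ∈-expansion i = ∈-resp-↭ (↭-sym (leaves↭ (Pointwiseᵥ.lookup es≈ i)))
      adj-≡ : ∀ {a b} → a ∈ leavesV ts → b ∈ leavesV ts → adj (gnode k H es) a b ≡ adj (gnode k H ts) a b
      adj-≡ a∈ b∈ with ∈-leavesV⁻ {ts = ts} a∈ | ∈-leavesV⁻ {ts = ts} b∈
      ... | i , a∈i | j , b∈j with i ≟ j
      ... | yes refl = begin
        adj (gnode k H es) _ _ ≡⟨ adj-gnode-inside H es u-es i (∈-expansion i a∈i) (∈-expansion i b∈j) ⟩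
        adj (lookup es i) _ _  ≡⟨ adj≡ (Pointwiseᵥ.lookup es≈ i) a∈i b∈j ⟩
        adj (lookup ts i) _ _  ≡⟨ adj-gnode-inside H ts u i a∈i b∈j ⟨
        adj (gnode k H ts) _ _ ∎
        where open ≡-Reasoning
      ... | no i≢j = trans (adj-gnode-across H es u-es i j i≢j (∈-expansion i a∈i) (∈-expansion j b∈j))
                           (sym (adj-gnode-across H ts u i j i≢j a∈i b∈j))
      edges-≡ : 2 ≤ k → edgesV es + ((k ∸ 2) + sum (map excess (nonlinDegreesV ts))) + 2 ≡ 2 * length (leavesV ts)
      edges-≡ (s≤s (s≤s {n = k′} _)) = trans (arith (edgesV es) k′ (sum (map excess (nonlinDegreesV ts)))) (edgesV-expansions es≈)
        where arith : ∀ a b c → a + (b + c) + 2 ≡ a + c + suc (suc b)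
              arith = solve-∀

  expansion-lin : ∀ s (cs : List (Tree n)) → WFLocal (lin s cs) → Unique (leavesL cs) →
    ∀ {es bt} → Pointwise _IsExpansionOf_ es cs → bt ∈ binTrees es → nestLin s bt IsExpansionOf lin s cs
  expansion-lin s (c ∷ []) (s≤s () , _)
  expansion-lin s cs@(c ∷ c′ ∷ cs′) (_ , sorted) u {es@(e ∷ e′ ∷ es′)} {bt} es≈@(_ ∷ _ ∷ _) bt∈ = record
    { isWF = nestLin-wf s bt bt-sorted (λ x∈ → isWF (proj₂ (tip-expansion x∈)))
    ; isPrime = Every-nestLin s (λ _ _ → tt) bt (λ x∈ → isPrime (proj₂ (tip-expansion x∈)))
    ; isBinary = Every-nestLin s (λ _ _ → refl) bt (λ x∈ → isBinary (proj₂ (tip-expansion x∈)))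
    ; leaves↭ = leaves-↭
    ; adj≡ = adj-≡
    ; sign≡ = cong (linSign ∘ nestLin s) (proj₂ (proj₂ (binTrees-fork {b = e} {c = e′} {bs = es′} bt∈)))
    ; edges≡ = edges-≡
    }
    where
      bt-sorted : KM.Sorted bt
      bt-sorted = proj₂ (KM.binTrees-sorted (sorted-expansions es≈ (Linked-minLeaf⇒sorted sorted)) bt∈)
      tips↭ : tips bt ↭ es
      tips↭ = tips-binTrees bt∈
      tip-expansion : ∀ {x} → x ∈ tips bt → Σ (Tree n) (x IsExpansionOf_)
      tip-expansion x∈ = let (c , _ , x≈) = Pointwise-∈ˡ es≈ (∈-resp-↭ tips↭ x∈) in c , x≈
      leaves-↭ : leaves (nestLin s bt) ↭ leavesL cs
      leaves-↭ = ↭-trans (leaves-nestLin s bt) (↭-trans (leavesL-↭ tips↭) (leavesL-expansions es≈))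
      u-bt : Unique (leaves (nestLin s bt))
      u-bt = Unique-resp-↭ (↭-sym leaves-↭) u
      adj-≡ : ∀ {a b} → a ∈ leavesL cs → b ∈ leavesL cs → adj (nestLin s bt) a b ≡ adjLin s cs a b
      adj-≡ {a} {b} a∈ b∈ with ∈-leavesL⁻ a∈
      ... | d , d∈ , a∈d with Pointwise-∈ʳ es≈ d∈
      ... | x , x∈ , x≈ with ∈-leaves-dec d b
      ... | inj₁ b∈d = begin
        adj (nestLin s bt) a b ≡⟨ adj-nestLin-inside s bt u-bt (∈-resp-↭ (↭-sym tips↭) x∈) (∈-x a∈d) (∈-x b∈d) ⟩
        adj x a b              ≡⟨ adj≡ x≈ a∈d b∈d ⟩
        adj d a b              ≡⟨ adjLin-inside s cs u d∈ a∈d b∈d ⟨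
        adjLin s cs a b        ∎
        where
          open ≡-Reasoning
          ∈-x : ∀ {a} → a ∈ leaves d → a ∈ leaves x
          ∈-x = ∈-resp-↭ (↭-sym (leaves↭ x≈))
      ... | inj₂ b∉d = trans (adj-nestLin-across s bt u-bt (∈-resp-↭ (↭-sym tips↭) x∈) (∈-resp-↭ (↭-sym (leaves↭ x≈)) a∈d)
                               (∈-resp-↭ (↭-sym leaves-↭) b∈) (b∉d ∘ ∈-resp-↭ (leaves↭ x≈)))
                             (sym (adjLin-across s cs u d∈ a∈d b∈ b∉d))
      edges-≡ : edges (nestLin s bt) + sum (map excess (nonlinDegreesL cs)) + 2 ≡ 2 * length (leavesL cs)
      edges-≡ rewrite edges-nestLin s bt = begin
        E + 2 * forks bt + X + 2          ≡⟨ arith E (forks bt) X ⟩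
        E + X + 2 * suc (forks bt)        ≡⟨ cong (λ m → E + X + 2 * m) (trans (forks-binTrees {bs = es} bt∈) (Pointwise-length es≈)) ⟩
        E + X + 2 * length cs             ≡⟨ cong (λ m → m + X + 2 * length cs) (sum-↭ (map⁺ edges tips↭)) ⟩
        sum (map edges es) + X + 2 * length cs ≡⟨ edgesL-expansions es≈ ⟩
        2 * length (leavesL cs)           ∎
        where
          open ≡-Reasoning
          E X : ℕ
          E = sum (map edges (tips bt))
          X = sum (map excess (nonlinDegreesL cs))
          arith : ∀ a b c → a + 2 * b + c + 2 ≡ a + c + 2 * suc b
          arith = solve-∀

  mutual
    expansions-sound : ∀ (τ : Tree n) → Every WFLocal τ → Every PrimeLocal τ → Unique (leaves τ) →
      ∀ {e} → e ∈ expansions τ → e IsExpansionOf τ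
    expansions-sound (leaf a) _ _ _ (here refl) = record
      { isWF = tt ; isPrime = tt ; isBinary = tt ; leaves↭ = ↭-refl ; adj≡ = λ _ _ → refl ; sign≡ = refl ; edges≡ = refl }
    expansions-sound (lin s cs) (wf , wfs) (_ , primes) u e∈
      with es , es∈ , e∈′ ← find (∈-concatMap⁻ (map (nestLin s) ∘ binTrees) {xs = expansionsL cs} e∈)
      with bt , bt∈ , refl ← ∈-map⁻ (nestLin s) e∈′ =
      expansion-lin s cs wf u (expansions-soundL cs wfs primes u (∈-expansionsL⁻ es∈)) bt∈
    expansions-sound (gnode k H ts) (wf , wfs) (prime , primes) u e∈
      with es , es∈ , refl ← ∈-map⁻ (gnode k H) e∈ =
      expansion-gnode H ts es wf prime u (expansions-soundV ts wfs primes u (∈-expansionsV⁻ es∈))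

    expansions-soundL : ∀ (cs : List (Tree n)) → EveryL WFLocal cs → EveryL PrimeLocal cs → Unique (leavesL cs) →
      ∀ {es} → Pointwise _Expands_ es cs → Pointwise _IsExpansionOf_ es cs
    expansions-soundL [] _ _ _ [] = []
    expansions-soundL (c ∷ cs) (wf , wfs) (prime , primes) u (e∈ ∷ es∈) =
      expansions-sound c wf prime (Unique-++⁻ˡ u) e∈ ∷ expansions-soundL cs wfs primes (Unique-++⁻ʳ (leaves c) u) es∈

    expansions-soundV : ∀ {k} (ts : Vec (Tree n) k) → EveryV WFLocal ts → EveryV PrimeLocal ts → Unique (leavesV ts) →
      ∀ {es} → Pointwiseᵥ.Pointwise _Expands_ es ts → Pointwiseᵥ.Pointwise _IsExpansionOf_ es ts
    expansions-soundV [] _ _ _ [] = []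
    expansions-soundV (t ∷ ts) (wf , wfs) (prime , primes) u (e∈ ∷ es∈) =
      expansions-sound t wf prime (Unique-++⁻ˡ u) e∈ ∷ expansions-soundV ts wfs primes (Unique-++⁻ʳ (leaves t) u) es∈

-- Distinct bracketings give distinct expansions

module _ {n : ℕ} where

  nestLin-injective : ∀ s (bt bt′ : BinTree (Tree n)) → (∀ {x} → x ∈ tips bt → linSign x ≢ just s) →
    (∀ {x} → x ∈ tips bt′ → linSign x ≢ just s) → nestLin s bt ≡ nestLin s bt′ → bt ≡ bt′
  nestLin-injective s (tip _) (tip _) _ _ refl = refl
  nestLin-injective s (tip _) (fork _ _) ¬s _ e = ⊥-elim (¬s (here refl) (cong linSign e))
  nestLin-injective s (fork _ _) (tip _) _ ¬s′ e = ⊥-elim (¬s′ (here refl) (cong linSign (sym e)))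
  nestLin-injective s (fork x y) (fork x′ y′) ¬s ¬s′ e with lin₂-injective e
    where
      lin₂-injective : ∀ {s s′ : Bool} {a b a′ b′ : Tree n} →
        lin s (a ∷ b ∷ []) ≡ lin s′ (a′ ∷ b′ ∷ []) → a ≡ a′ × b ≡ b′
      lin₂-injective refl = refl , refl
  ... | x≡ , y≡ = cong₂ fork (nestLin-injective s x x′ (¬s ∘ ∈-++⁺ˡ) (¬s′ ∘ ∈-++⁺ˡ) x≡)
                             (nestLin-injective s y y′ (¬s ∘ ∈-++⁺ʳ (tips x)) (¬s′ ∘ ∈-++⁺ʳ (tips x′)) y≡)

  -- Reducedness makes the bracketing recoverable: no child of an s-node is itself an s-node.
  Unique-expansions-lin : ∀ s (cs : List (Tree n)) → WFLocal (lin s cs) → EveryL WFLocal cs → EveryL PrimeLocal cs →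
    ReducedLocal (lin s cs) → Unique (leavesL cs) → Unique (expansionsL cs) → Unique (expansions (lin s cs))
  Unique-expansions-lin s cs (_ , sorted) wfs primes reduced u u-expansionsL =
    Unique-concatMap⁺ (map (nestLin s) ∘ binTrees) u-expansionsL Unique-nestLins same-expansions
    where
      expansions≈ : ∀ {es} → es ∈ expansionsL cs → Pointwise _IsExpansionOf_ es cs
      expansions≈ es∈ = expansions-soundL cs wfs primes u (∈-expansionsL⁻ es∈)
      sorted-es : ∀ {es} → es ∈ expansionsL cs → AllPairs (λ a b → minLeaf a < minLeaf b) es
      sorted-es es∈ = sorted-expansions (expansions≈ es∈) (Linked-minLeaf⇒sorted sorted)
      tips-not-s : ∀ {es bt} → es ∈ expansionsL cs → bt ∈ binTrees es → ∀ {x} → x ∈ tips bt → linSign x ≢ just s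
      tips-not-s {es} es∈ bt∈ x∈ with Pointwise-∈ˡ (expansions≈ es∈) (∈-resp-↭ (tips-binTrees {bs = es} bt∈) x∈)
      ... | c , c∈ , x≈ = λ sign-s → All.lookup reduced c∈ (trans (sym (sign≡ x≈)) sign-s)
      Unique-nestLins : ∀ {es} → es ∈ expansionsL cs → Unique (map (nestLin s) (binTrees es))
      Unique-nestLins es∈ = Unique-map⁺-on (nestLin s) (KM.Unique-binTrees (sorted-es es∈))
        (λ bt∈ bt′∈ → nestLin-injective s _ _ (tips-not-s es∈ bt∈) (tips-not-s es∈ bt′∈))
      same-expansions : ∀ {es es′ v} → es ∈ expansionsL cs → es′ ∈ expansionsL cs →
        v ∈ map (nestLin s) (binTrees es) → v ∈ map (nestLin s) (binTrees es′) → es ≡ es′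
      same-expansions {es} {es′} es∈ es′∈ v∈ v∈′ with ∈-map⁻ (nestLin s) v∈ | ∈-map⁻ (nestLin s) v∈′
      ... | bt , bt∈ , refl | bt′ , bt′∈ , e
        with refl ← nestLin-injective s bt bt′ (tips-not-s es∈ bt∈) (tips-not-s es′∈ bt′∈) e =
        sorted-≡ minLeaf (sorted-es es∈) (sorted-es es′∈)
          (∈-resp-↭ (tips-binTrees {bs = es′} bt′∈) ∘ ∈-resp-↭ (↭-sym (tips-binTrees {bs = es} bt∈)))
          (∈-resp-↭ (tips-binTrees {bs = es} bt∈) ∘ ∈-resp-↭ (↭-sym (tips-binTrees {bs = es′} bt′∈)))

  mutual
    Unique-expansions : ∀ (τ : Tree n) → Every WFLocal τ → Every PrimeLocal τ → Every ReducedLocal τ → Unique (leaves τ) →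
      Unique (expansions τ)
    Unique-expansions (leaf _) _ _ _ _ = [] ∷ []
    Unique-expansions (lin s cs) (wf , wfs) (_ , primes) (reduced , reduceds) u =
      Unique-expansions-lin s cs wf wfs primes reduced u (Unique-expansionsL cs wfs primes reduceds u)
    Unique-expansions (gnode k H ts) (_ , wfs) (_ , primes) (_ , reduceds) u =
      UniqueP.map⁺ gnode-injective (Unique-expansionsV ts wfs primes reduceds u)
      where
        gnode-injective : ∀ {es es′ : Vec (Tree n) k} → gnode k H es ≡ gnode k H es′ → es ≡ es′
        gnode-injective refl = refl

    Unique-expansionsL : ∀ (cs : List (Tree n)) → EveryL WFLocal cs → EveryL PrimeLocal cs → EveryL ReducedLocal cs →
      Unique (leavesL cs) → Unique (expansionsL cs)
    Unique-expansionsL [] _ _ _ _ = [] ∷ []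
    Unique-expansionsL (c ∷ cs) (wf , wfs) (prime , primes) (reduced , reduceds) u =
      Unique-concatMap⁺ (λ e → map (e ∷_) (expansionsL cs)) (Unique-expansions c wf prime reduced (Unique-++⁻ˡ u))
        (λ _ → UniqueP.map⁺ ∷-injectiveʳ (Unique-expansionsL cs wfs primes reduceds (Unique-++⁻ʳ (leaves c) u)))
        λ {x} {y} _ _ v∈x v∈y → let (_ , _ , v≡x∷) = ∈-map⁻ (x ∷_) v∈x ; (_ , _ , v≡y∷) = ∈-map⁻ (y ∷_) v∈y in
          ∷-injectiveˡ (trans (sym v≡x∷) v≡y∷)

    Unique-expansionsV : ∀ {k} (ts : Vec (Tree n) k) → EveryV WFLocal ts → EveryV PrimeLocal ts → EveryV ReducedLocal ts →
      Unique (leavesV ts) → Unique (expansionsV ts)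
    Unique-expansionsV [] _ _ _ _ = [] ∷ []
    Unique-expansionsV (t ∷ ts) (wf , wfs) (prime , primes) (reduced , reduceds) u =
      Unique-concatMap⁺ (λ e → map (e ∷_) (expansionsV ts)) (Unique-expansions t wf prime reduced (Unique-++⁻ˡ u))
        (λ _ → UniqueP.map⁺ Vecₚ.∷-injectiveʳ (Unique-expansionsV ts wfs primes reduceds (Unique-++⁻ʳ (leaves t) u)))
        λ {x} {y} _ _ v∈x v∈y → let (_ , _ , v≡x∷) = ∈-map⁻ (x ∷_) v∈x ; (_ , _ , v≡y∷) = ∈-map⁻ (y ∷_) v∈y in
          Vecₚ.∷-injectiveˡ (trans (sym v≡x∷) v≡y∷)

-- Uniform cuts and modules in realizations of a graph

module _ {n : ℕ} where

  leaf-outside-child : ∀ {cs : List (Tree n)} {c} → 2 ≤ length cs → (∀ {d} → d ∈ cs → Σ (Fin n) (_∈ leaves d)) →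
    Unique (leavesL cs) → c ∈ cs → Σ (Fin n) λ z → z ∈ leavesL cs × z ∉ leaves c
  leaf-outside-child {_ ∷ []} (s≤s ()) _ _ _
  leaf-outside-child {c₁ ∷ c₂ ∷ cs} {c} _ nonempty u c∈ with nonempty (here refl) | nonempty (there (here refl))
  ... | l₁ , l₁∈ | l₂ , l₂∈ with ∈-leaves-dec c l₁
  ... | inj₂ l₁∉ = l₁ , ∈-leavesL⁺ {cs = c₁ ∷ c₂ ∷ cs} (here refl) l₁∈ , l₁∉
  ... | inj₁ l₁∈c with refl ← Unique-leavesL-sameChild u c∈ (here refl) l₁∈c l₁∈ =
    l₂ , ∈-leavesL⁺ {cs = c₁ ∷ c₂ ∷ cs} (there (here refl)) l₂∈ ,
    λ l₂∈c → Unique-++⇒disjoint {xs = leaves c₁} u l₂∈c (∈-leavesL⁺ {cs = c₂ ∷ cs} (here refl) l₂∈)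

module Realizing {n : ℕ} (A : Fin n → Fin n → Bool) (A-sym : ∀ a b → A a b ≡ A b a) where

  RealizesOn : Tree n → Set
  RealizesOn u = ∀ {a b} → a ∈ leaves u → b ∈ leaves u → adj u a b ≡ A a b

  record GoodTree (Q : Tree n → Set) (u : Tree n) : Set where
    constructor goodTree
    field
      wellFormed : Every WFLocal u
      primes : Every PrimeLocal u
      shape : Every Q u
      uniqueLeaves : Unique (leaves u)
      realizes : RealizesOn u
  open GoodTree public

  UniformCut : Bool → List (Fin n) → (Fin n → Bool) → Set
  UniformCut s as p = ∀ {x y} → x ∈ as → y ∈ as → p x ≡ true → p y ≡ false → A x y ≡ s

  IsModuleOn : List (Fin n) → (Fin n → Bool) → Set
  IsModuleOn as p = ∀ {x y z} → x ∈ as → y ∈ as → z ∈ as → p x ≡ false → p y ≡ true → p z ≡ true → A x y ≡ A x z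

  UniformCut-not : ∀ {s as p} → UniformCut s as p → UniformCut s as (not ∘ p)
  UniformCut-not {p = p} cut {x} {y} x∈ y∈ ¬px ¬py with p x in px | p y in py
  UniformCut-not cut x∈ y∈ refl refl | false | true = trans (A-sym _ _) (cut y∈ x∈ py px)

  module _ {Q : Tree n → Set} where

    good-child : ∀ {s cs c} → GoodTree Q (lin s cs) → c ∈ cs → GoodTree Q c
    good-child {s} {cs} g c∈ = goodTree (EveryL-∈ (proj₂ (wellFormed g)) c∈) (EveryL-∈ (proj₂ (primes g)) c∈)
      (EveryL-∈ (proj₂ (shape g)) c∈) (Unique-leavesL-child (uniqueLeaves g) c∈)
      (λ a∈ b∈ → trans (sym (adjLin-inside s cs (uniqueLeaves g) c∈ a∈ b∈))
                        (realizes g (∈-leavesL⁺ c∈ a∈) (∈-leavesL⁺ c∈ b∈)))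

    good-lookup : ∀ {k H ts} → GoodTree Q (gnode k H ts) → (i : Fin k) → GoodTree Q (lookup ts i)
    good-lookup {k} {H} {ts} g i = goodTree (EveryV-lookup {ts = ts} (proj₂ (wellFormed g)) i)
      (EveryV-lookup {ts = ts} (proj₂ (primes g)) i) (EveryV-lookup {ts = ts} (proj₂ (shape g)) i)
      (Unique-leavesV-child {ts = ts} (uniqueLeaves g) i)
      (λ a∈ b∈ → trans (sym (adj-gnode-inside H ts (uniqueLeaves g) i a∈ b∈))
                        (realizes g (∈-leavesV⁺ {ts = ts} i a∈) (∈-leavesV⁺ {ts = ts} i b∈)))

    A-across-lin : ∀ {s cs c a b} → GoodTree Q (lin s cs) → c ∈ cs → a ∈ leaves c → b ∈ leavesL cs → b ∉ leaves c → A a b ≡ s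
    A-across-lin {s} {cs} g c∈ a∈ b∈ b∉ =
      trans (sym (realizes g (∈-leavesL⁺ c∈ a∈) b∈)) (adjLin-across s cs (uniqueLeaves g) c∈ a∈ b∈ b∉)

    A-across-gnode : ∀ {k H ts} → GoodTree Q (gnode k H ts) → ∀ {i j a b} → i ≢ j →
      a ∈ leaves (lookup ts i) → b ∈ leaves (lookup ts j) → A a b ≡ matAdj H i j
    A-across-gnode {k} {H} {ts} g {i} {j} i≢j a∈ b∈ =
      trans (sym (realizes g (∈-leavesV⁺ {ts = ts} i a∈) (∈-leavesV⁺ {ts = ts} j b∈)))
            (adj-gnode-across H ts (uniqueLeaves g) i j i≢j a∈ b∈)

    block-leaf : ∀ {k H ts} → GoodTree Q (gnode k H ts) → (q : Fin k) → Σ (Fin n) λ a → a ∈ leaves (lookup ts q)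
    block-leaf {ts = ts} g q = leaves-nonempty (lookup ts q) (EveryV-lookup {ts = ts} (proj₂ (wellFormed g)) q)

    lin-leaf-outside-child : ∀ {s cs c} → GoodTree Q (lin s cs) → c ∈ cs → Σ (Fin n) λ z → z ∈ leavesL cs × z ∉ leaves c
    lin-leaf-outside-child g = leaf-outside-child (proj₁ (proj₁ (wellFormed g)))
      (λ {d} d∈ → leaves-nonempty d (EveryL-∈ (proj₂ (wellFormed g)) d∈)) (uniqueLeaves g)

    two-leaves : ∀ {u} → GoodTree Q u → (∀ a → u ≢ leaf a) →
      Σ (Fin n) λ x → Σ (Fin n) λ y → x ∈ leaves u × y ∈ leaves u × x ≢ y
    two-leaves {leaf a} _ not-leaf = ⊥-elim (not-leaf a refl)
    two-leaves {lin s []} g _ with () ← proj₁ (proj₁ (wellFormed g))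
    two-leaves {lin s (c ∷ cs)} g _ with leaves-nonempty c (proj₁ (proj₂ (wellFormed g))) | lin-leaf-outside-child g (here refl)
    ... | x , x∈ | z , z∈ , z∉ = x , z , ∈-leavesL⁺ {cs = c ∷ cs} (here refl) x∈ , z∈ , λ { refl → z∉ x∈ }
    two-leaves {gnode (suc (suc k)) H ts} g _ with block-leaf g zero | block-leaf g (suc zero)
    ... | x , x∈ | y , y∈ = x , y , ∈-leavesV⁺ {ts = ts} zero x∈ , ∈-leavesV⁺ {ts = ts} (suc zero) y∈ ,
      λ { refl → 0≢1 (Unique-leavesV-sameIndex {ts = ts} (uniqueLeaves g) zero (suc zero) x∈ y∈) }
      where 0≢1 : zero ≢ suc zero
            0≢1 ()
    two-leaves {gnode zero H ts} g _ with () ← proj₁ (proj₁ (wellFormed g))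
    two-leaves {gnode (suc zero) H ts} g _ with s≤s () ← proj₁ (proj₁ (wellFormed g))

    -- In a prime node each block is monochromatic for a uniform cut: otherwise its index would see all others alike.
    module Cut {k H ts} (g : GoodTree Q (gnode k H ts)) {s p} (cut : UniformCut s (leavesV ts) p) where

      private
        prime : IsPrime (matAdj H)
        prime = proj₁ (primes g)
        ∈ts : ∀ q {a} → a ∈ leaves (lookup ts q) → a ∈ leavesV ts
        ∈ts q = ∈-leavesV⁺ {ts = ts} q

      split-block-uniform : ∀ r {a b} → a ∈ leaves (lookup ts r) → b ∈ leaves (lookup ts r) → p a ≡ true → p b ≡ false →
        ∀ q → q ≢ r → matAdj H r q ≡ s
      split-block-uniform r {a} {b} a∈ b∈ pa pb q q≢r with block-leaf g q
      ... | z , z∈ with p z in pz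
      ... | true = trans (sym (A-across-gnode g (q≢r ∘ sym) b∈ z∈)) (trans (A-sym b z) (cut (∈ts q z∈) (∈ts r b∈) pz pb))
      ... | false = trans (sym (A-across-gnode g (q≢r ∘ sym) a∈ z∈)) (cut (∈ts r a∈) (∈ts q z∈) pa pz)

      block-monochromatic : ∀ r {a b} → a ∈ leaves (lookup ts r) → b ∈ leaves (lookup ts r) → p a ≡ true → p b ≡ false → ⊥
      block-monochromatic r a∈ b∈ pa pb = prime⇒no-uniform-vertex (matAdj H) prime r
        (λ q q′ q≢r q′≢r → trans (split-block-uniform r a∈ b∈ pa pb q q≢r)
                                 (sym (split-block-uniform r a∈ b∈ pa pb q′ q′≢r)))

      colour : Fin k → Bool
      colour q = p (proj₁ (block-leaf g q))

      colour-leaf : ∀ q {a} → a ∈ leaves (lookup ts q) → p a ≡ colour q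
      colour-leaf q {a} a∈ with p a in pa | colour q in pq
      ... | true | true = refl
      ... | false | false = refl
      ... | true | false = ⊥-elim (block-monochromatic q a∈ (proj₂ (block-leaf g q)) pa pq)
      ... | false | true = ⊥-elim (block-monochromatic q (proj₂ (block-leaf g q)) a∈ pq pa)

      coloured-blocks-module : IsModule (matAdj H) (tabulate colour)
      coloured-blocks-module q y z q∉ y∈ z∈ = trans (H-q y y∈) (sym (H-q z z∈))
        where
          H-q : ∀ w → w ∈S tabulate colour → matAdj H q w ≡ s
          H-q w w∈ = trans (sym (A-across-gnode g q≢w (proj₂ (block-leaf g q)) (proj₂ (block-leaf g w))))
            (trans (A-sym _ _) (cut (∈ts w (proj₂ (block-leaf g w))) (∈ts q (proj₂ (block-leaf g q)))
                                    (∈-tabulate⁻ w∈) (∉-tabulate⁻ q∉)))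
            where q≢w : q ≢ w
                  q≢w refl = q∉ w∈

    no-uniform-cut : ∀ s u → GoodTree Q u → linSign u ≢ just s → ∀ p → UniformCut s (leaves u) p →
      ∀ {x y} → x ∈ leaves u → y ∈ leaves u → p x ≡ true → p y ≡ false → ⊥
    no-uniform-cut s (leaf a) _ _ _ _ (here refl) (here refl) px py with () ← trans (sym px) py
    no-uniform-cut s (lin s′ cs) g s′≢s p cut {x} {y} x∈ y∈ px py with ∈-leavesL⁻ x∈
    ... | c , c∈ , x∈c with ∈-leaves-dec c y
    ... | inj₂ y∉c = s′≢s (cong just (trans (sym (A-across-lin g c∈ x∈c y∈ y∉c)) (cut x∈ y∈ px py)))
    ... | inj₁ y∈c with lin-leaf-outside-child g c∈
    ... | z , z∈ , z∉c with p z in pz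
    ... | true = s′≢s (cong just (trans (sym (A-across-lin g c∈ y∈c z∈ z∉c)) (trans (A-sym y z) (cut z∈ y∈ pz py))))
    ... | false = s′≢s (cong just (trans (sym (A-across-lin g c∈ x∈c z∈ z∉c)) (cut x∈ z∈ px pz)))
    no-uniform-cut s (gnode k H ts) g _ p cut {x} {y} x∈ y∈ px py
      with ∈-leavesV⁻ {ts = ts} x∈ | ∈-leavesV⁻ {ts = ts} y∈
    ... | i , x∈i | j , y∈j with i ≟ j
    ... | yes refl = Cut.block-monochromatic g cut i x∈i y∈j px py
    ... | no i≢j with third-vertex (proj₁ (proj₁ (primes g))) i j
    ... | q , q≢i , q≢j with Cut.colour g cut q in cq
    ... | true = two-in-one-out⇒¬trivial {z = j}
      (∈-tabulate⁺ (trans (sym (colour-leaf i x∈i)) px)) (∈-tabulate⁺ cq) (q≢i ∘ sym)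
      (∉-tabulate⁺ (trans (sym (colour-leaf j y∈j)) py)) (proj₂ (proj₁ (primes g)) _ coloured-blocks-module)
      where open Cut g cut
    ... | false = two-in-one-out⇒¬trivial {z = i}
      (∈-tabulate⁺ (trans (sym (colour-leaf j y∈j)) (cong not py))) (∈-tabulate⁺ (cong not cq)) (q≢j ∘ sym)
      (∉-tabulate⁺ (trans (sym (colour-leaf i x∈i)) (cong not px))) (proj₂ (proj₁ (primes g)) _ coloured-blocks-module)
      where open Cut g (UniformCut-not cut)

    -- The blocks meeting the module form a module of H; if it were all of H, the block of w would see all others alike.
    module-inside-block : ∀ {k H ts} → GoodTree Q (gnode k H ts) → ∀ p → IsModuleOn (leavesV ts) p →
      ∀ {w} → w ∈ leavesV ts → p w ≡ false →
      ∀ {y z i j} → y ∈ leaves (lookup ts i) → z ∈ leaves (lookup ts j) → p y ≡ true → p z ≡ true → i ≡ j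
    module-inside-block {k} {H} {ts} g p module-p {w} w∈ pw {i = i} {j} y∈ z∈ py pz =
      trivial⇒same-block (proj₂ prime M M-module)
      where
        prime : IsPrime (matAdj H)
        prime = proj₁ (primes g)
        meets? : ∀ q → Dec (Any (λ a → p a ≡ true) (leaves (lookup ts q)))
        meets? q = any? (λ a → p a ≟B true) (leaves (lookup ts q))
        M : Subset k
        M = tabulate (does ∘ meets?)
        ∈ts : ∀ q {a} → a ∈ leaves (lookup ts q) → a ∈ leavesV ts
        ∈ts q = ∈-leavesV⁺ {ts = ts} q
        ∈M : ∀ {q a} → a ∈ leaves (lookup ts q) → p a ≡ true → q ∈S M
        ∈M {q} a∈ pa = ∈-tabulate⁺ (dec-true (meets? q) (lose a∈ pa))
        ∉M : ∀ {q a} → q ∉S M → a ∈ leaves (lookup ts q) → p a ≡ false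
        ∉M {a = a} q∉ a∈ with p a in pa
        ... | false = refl
        ... | true = ⊥-elim (q∉ (∈M a∈ pa))
        witness : ∀ v → v ∈S M → Σ (Fin n) λ b → b ∈ leaves (lookup ts v) × p b ≡ true
        witness v v∈ with meets? v | ∈-tabulate⁻ v∈
        ... | yes m | _ = find m
        A-witness : ∀ {q a} → a ∈ leaves (lookup ts q) → ∀ v (v∈ : v ∈S M) → q ≢ v →
          A a (proj₁ (witness v v∈)) ≡ matAdj H q v
        A-witness a∈ v v∈ q≢v = A-across-gnode g q≢v a∈ (proj₁ (proj₂ (witness v v∈)))
        module-witness : ∀ {q a} → a ∈ leaves (lookup ts q) → p a ≡ false → ∀ v v′ (v∈ : v ∈S M) (v′∈ : v′ ∈S M) →
          A a (proj₁ (witness v v∈)) ≡ A a (proj₁ (witness v′ v′∈))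
        module-witness {q} a∈ pa v v′ v∈ v′∈ =
          module-p (∈ts q a∈) (∈ts v (proj₁ (proj₂ (witness v v∈)))) (∈ts v′ (proj₁ (proj₂ (witness v′ v′∈))))
            pa (proj₂ (proj₂ (witness v v∈))) (proj₂ (proj₂ (witness v′ v′∈)))
        M-module : IsModule (matAdj H) M
        M-module q v v′ q∉ v∈ v′∈ =
          let (a , a∈) = block-leaf g q in
          trans (sym (A-witness a∈ v v∈ (λ { refl → q∉ v∈ })))
                (trans (module-witness a∈ (∉M q∉ a∈) v v′ v∈ v′∈) (A-witness a∈ v′ v′∈ (λ { refl → q∉ v′∈ })))
        trivial⇒same-block : IsTrivialModule M → i ≡ j
        trivial⇒same-block (inj₁ ∣M∣≤1) = ∣p∣≤1⇒x≡y M ∣M∣≤1 (∈M y∈ py) (∈M z∈ pz)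
        trivial⇒same-block (inj₂ M≡⊤) = ⊥-elim (prime⇒no-uniform-vertex (matAdj H) prime r
          λ v v′ v≢r v′≢r → trans (sym (A-witness w∈r v (all v) (v≢r ∘ sym)))
                                   (trans (module-witness w∈r pw v v′ (all v) (all v′)) (A-witness w∈r v′ (all v′) (v′≢r ∘ sym))))
          where
            all : ∀ v → v ∈S M
            all v = subst (v ∈S_) (sym M≡⊤) ∈⊤
            r : Fin k
            r = proj₁ (∈-leavesV⁻ {ts = ts} w∈)
            w∈r : w ∈ leaves (lookup ts r)
            w∈r = proj₂ (∈-leavesV⁻ {ts = ts} w∈)

-- Every expanded tree is an expansion

module Completeness {n : ℕ} (A : Fin n → Fin n → Bool) (A-sym : ∀ a b → A a b ≡ A b a) where
  open Realizing A A-sym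
  open import Data.List.Membership.DecPropositional (_≟_ {n}) using (_∈?_)

  Expanded : Tree n → Set
  Expanded = GoodTree BinaryLocal

  Reduced : Tree n → Set
  Reduced = GoodTree ReducedLocal

  record ReducedChildren (s : Bool) (cs : List (Tree n)) : Set where
    field
      children-reduced : ∀ {c} → c ∈ cs → Reduced c
      children-not-s : ∀ {c} → c ∈ cs → linSign c ≢ just s
      children-unique : Unique (leavesL cs)
      children-across : ∀ {c a b} → c ∈ cs → a ∈ leaves c → b ∈ leavesL cs → b ∉ leaves c → A a b ≡ s
      children-sorted : AllPairs (λ a b → minLeaf a < minLeaf b) cs
  open ReducedChildren

  reducedChildren : ∀ {s cs} → Reduced (lin s cs) → ReducedChildren s cs
  reducedChildren g = record
    { children-reduced = good-child g
    ; children-not-s = All.lookup (proj₁ (shape g))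
    ; children-unique = uniqueLeaves g
    ; children-across = A-across-lin g
    ; children-sorted = Linked-minLeaf⇒sorted (proj₂ (proj₁ (wellFormed g)))
    }

  reducedChildren-interleaving : ∀ {s cs xs ys} → ReducedChildren s cs → Interleaving xs ys cs →
    ReducedChildren s xs × ReducedChildren s ys
  reducedChildren-interleaving {s} {cs} {xs} {ys} rc i =
    restrict (Interleaving-∈ˡ i) (Unique-++⁻ˡ u) (AllPairs-interleavingˡ i (children-sorted rc)) ,
    restrict (Interleaving-∈ʳ i) (Unique-++⁻ʳ (leavesL xs) u) (AllPairs-interleavingʳ i (children-sorted rc))
    where
      u : Unique (leavesL xs ++ leavesL ys)
      u = subst Unique (leavesL-++ xs ys) (Unique-resp-↭ (leavesL-↭ (toPermutation i)) (children-unique rc))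
      restrict : ∀ {zs} → (∀ {c} → c ∈ zs → c ∈ cs) → Unique (leavesL zs) → AllPairs (λ a b → minLeaf a < minLeaf b) zs →
        ReducedChildren s zs
      restrict ⊆cs u-zs sorted-zs = record
        { children-reduced = children-reduced rc ∘ ⊆cs
        ; children-not-s = children-not-s rc ∘ ⊆cs
        ; children-unique = u-zs
        ; children-across = λ c∈ a∈ b∈ b∉ →
            let (d , d∈ , b∈d) = ∈-leavesL⁻ b∈ in children-across rc (⊆cs c∈) a∈ (∈-leavesL⁺ (⊆cs d∈) b∈d) b∉
        ; children-sorted = sorted-zs
        }

  SameLeaves : Tree n → List (Fin n) → Set
  SameLeaves t as = (∀ {a} → a ∈ leaves t → a ∈ as) × (∀ {a} → a ∈ as → a ∈ leaves t)

  Bracketed : Bool → List (Tree n) → Tree n → Set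
  Bracketed s cs t = Σ (List (Tree n)) λ es → Σ (BinTree (Tree n)) λ bt →
    Pointwise _Expands_ es cs × bt ∈ binTrees es × t ≡ nestLin s bt

  bracketed⇒expansion : ∀ {s cs t} → Bracketed s cs t → t ∈ expansions (lin s cs)
  bracketed⇒expansion {s} (es , bt , es∈ , bt∈ , refl) =
    ∈-concatMap⁺ (map (nestLin s) ∘ binTrees) (lose (∈-expansionsL⁺ es∈) (∈-map⁺ (nestLin s) bt∈))

  CompleteUpTo : ℕ → Set
  CompleteUpTo N = ∀ t τ → length (leaves t) ≤ N → Expanded t → Reduced τ → SameLeaves t (leaves τ) → t ∈ expansions τ

  CompleteLUpTo : ℕ → Set
  CompleteLUpTo N = ∀ s t cs → length (leaves t) ≤ N → Expanded t → ReducedChildren s cs → SameLeaves t (leavesL cs) → Bracketed s cs t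

  ∈-leaves-lin₂⁻ : ∀ {s} {X Y : Tree n} {a} → a ∈ leaves (lin s (X ∷ Y ∷ [])) → a ∈ leaves X ⊎ a ∈ leaves Y
  ∈-leaves-lin₂⁻ {X = X} {Y} a∈ with ∈-++⁻ (leaves X) a∈
  ... | inj₁ a∈X = inj₁ a∈X
  ... | inj₂ a∈Y with ∈-++⁻ (leaves Y) a∈Y
  ... | inj₁ a∈Y′ = inj₂ a∈Y′

  ∈-leaves-lin₂ʳ : ∀ {s} {X Y : Tree n} {a} → a ∈ leaves Y → a ∈ leaves (lin s (X ∷ Y ∷ []))
  ∈-leaves-lin₂ʳ {X = X} a∈ = ∈-++⁺ʳ (leaves X) (∈-++⁺ˡ a∈)

  length-leaves-lin₂ˡ : ∀ {s} {X Y : Tree n} {a} → a ∈ leaves Y → length (leaves X) < length (leaves (lin s (X ∷ Y ∷ [])))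
  length-leaves-lin₂ˡ {X = X} {Y} a∈ rewrite length-++ (leaves X) {leaves Y ++ []} =
    subst (_≤ length (leaves X) + length (leaves Y ++ [])) (+-comm (length (leaves X)) 1)
      (+-monoʳ-≤ (length (leaves X)) (∈-length (∈-++⁺ˡ {ys = []} a∈)))

  length-leaves-lin₂ʳ : ∀ {s} {X Y : Tree n} {a} → a ∈ leaves X → length (leaves Y) < length (leaves (lin s (X ∷ Y ∷ [])))
  length-leaves-lin₂ʳ {X = X} {Y} a∈ rewrite length-++ (leaves X) {leaves Y ++ []} | length-++ (leaves Y) {[]} =
    ≤-trans (s≤s (m≤m+n (length (leaves Y)) 0)) (+-monoˡ-≤ (length (leaves Y) + 0) (∈-length a∈))

  single-leaf-impossible : ∀ {Q u b} → GoodTree Q u → (∀ a → u ≢ leaf a) → ¬ (∀ {x} → x ∈ leaves u → x ∈ b ∷ [])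
  single-leaf-impossible g not-leaf ⊆[b] with two-leaves g not-leaf
  ... | x , y , x∈ , y∈ , x≢y with ⊆[b] x∈ | ⊆[b] y∈
  ... | here refl | here refl = x≢y refl

  -- The children of the s-node give an s-uniform cut of the leaves of u.
  lin-sign-forced : ∀ {Q Q′ s cs u} → GoodTree Q (lin s cs) → GoodTree Q′ u → linSign u ≢ just s →
    ¬ SameLeaves u (leaves (lin s cs))
  lin-sign-forced {s = s} {[]} g _ _ _ with () ← proj₁ (proj₁ (wellFormed g))
  lin-sign-forced {s = s} {c ∷ cs} {u} g gu ¬s (u⊆ , ⊆u)
    with leaves-nonempty c (proj₁ (proj₂ (wellFormed g))) | lin-leaf-outside-child g (here refl)
  ... | x , x∈ | z , z∈ , z∉ =
    no-uniform-cut s u gu ¬s (memT c)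
      (λ _ y∈ px py → A-across-lin g (here refl) (memT-true⁻ c px) (u⊆ y∈) (memT-false⁻ c py))
      (⊆u (∈-++⁺ˡ x∈)) (⊆u z∈) (memT-true c x∈) (memT-false c z∉)

  children-sign-forced : ∀ {s c₁ c₂ cs t} → ReducedChildren s (c₁ ∷ c₂ ∷ cs) → Expanded t → linSign t ≢ just s →
    ¬ SameLeaves t (leavesL (c₁ ∷ c₂ ∷ cs))
  children-sign-forced {s} {c₁} {c₂} {cs} {t} rc gt ¬s (t⊆ , ⊆t)
    with leaves-nonempty c₁ (wellFormed (children-reduced rc (here refl)))
       | leaves-nonempty c₂ (wellFormed (children-reduced rc (there (here refl))))
  ... | x , x∈ | y , y∈ =
    no-uniform-cut s t gt ¬s (memT c₁)
      (λ _ y∈t px py → children-across rc (here refl) (memT-true⁻ c₁ px) (t⊆ y∈t) (memT-false⁻ c₁ py))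
      (⊆t (∈-leavesL⁺ {cs = c₁ ∷ c₂ ∷ cs} (here refl) x∈))
      (⊆t (∈-leavesL⁺ {cs = c₁ ∷ c₂ ∷ cs} (there (here refl)) y∈))
      (memT-true c₁ x∈) (memT-false c₁ λ y∈c₁ → Unique-++⇒disjoint {xs = leaves c₁} (children-unique rc) y∈c₁ (∈-++⁺ˡ y∈))

  -- An expanded s-node X ⊕ Y with the leaves of the children of an s-node: every child lies inside X or inside Y,
  -- the first child inside X, so X and Y are bracketings of two complementary subsequences of the children.
  module SameSign (N : ℕ) (s : Bool) (X Y c₁ : Tree n) (cs′ : List (Tree n))
    (t-size : length (leaves (lin s (X ∷ Y ∷ []))) ≤ suc N) (gt : Expanded (lin s (X ∷ Y ∷ [])))
    (rc : ReducedChildren s (c₁ ∷ cs′)) (same : SameLeaves (lin s (X ∷ Y ∷ [])) (leavesL (c₁ ∷ cs′)))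
    (IH : CompleteLUpTo N) where

    private
      t : Tree n
      t = lin s (X ∷ Y ∷ [])
      cs : List (Tree n)
      cs = c₁ ∷ cs′
      gX : Expanded X
      gX = good-child gt (here refl)
      gY : Expanded Y
      gY = good-child gt (there (here refl))
      t⊆ : ∀ {a} → a ∈ leaves t → a ∈ leavesL cs
      t⊆ = proj₁ same
      ⊆t : ∀ {a} → a ∈ leavesL cs → a ∈ leaves t
      ⊆t = proj₂ same

    X∩Y-empty : ∀ {a} → a ∈ leaves X → a ∈ leaves Y → ⊥
    X∩Y-empty a∈X a∈Y = Unique-++⇒disjoint (uniqueLeaves gt) a∈X (∈-++⁺ˡ a∈Y)

    A-X-Y : ∀ {a b} → a ∈ leaves X → b ∈ leaves Y → A a b ≡ s
    A-X-Y a∈X b∈Y = A-across-lin gt (here refl) a∈X (∈-leaves-lin₂ʳ {s} {X} {Y} b∈Y) (λ b∈X → X∩Y-empty b∈X b∈Y)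

    Meets : Tree n → Set
    Meets c = Any (_∈ leaves X) (leaves c)

    meets? : Decidable Meets
    meets? c = any? (_∈? leaves X) (leaves c)

    child-inside-X : ∀ {c a b} → c ∈ cs → a ∈ leaves c → a ∈ leaves X → b ∈ leaves c → b ∈ leaves X
    child-inside-X {c} c∈ a∈c a∈X b∈c with ∈-leaves-lin₂⁻ {s} {X} {Y} (⊆t (∈-leavesL⁺ c∈ b∈c))
    ... | inj₁ b∈X = b∈X
    ... | inj₂ b∈Y = ⊥-elim (no-uniform-cut s c (children-reduced rc c∈) (children-not-s rc c∈) (memT X) X-Y-cut
                                a∈c b∈c (memT-true X a∈X) (memT-false X (λ b∈X → X∩Y-empty b∈X b∈Y)))
      where
        X-Y-cut : UniformCut s (leaves c) (memT X)
        X-Y-cut _ y∈c px py with ∈-leaves-lin₂⁻ {s} {X} {Y} (⊆t (∈-leavesL⁺ c∈ y∈c))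
        ... | inj₁ y∈X = ⊥-elim (memT-false⁻ X py y∈X)
        ... | inj₂ y∈Y = A-X-Y (memT-true⁻ X px) y∈Y

    child-inside-Y : ∀ {c b} → c ∈ cs → ¬ Meets c → b ∈ leaves c → b ∈ leaves Y
    child-inside-Y c∈ ¬meets b∈c with ∈-leaves-lin₂⁻ {s} {X} {Y} (⊆t (∈-leavesL⁺ c∈ b∈c))
    ... | inj₁ b∈X = ⊥-elim (¬meets (lose b∈c b∈X))
    ... | inj₂ b∈Y = b∈Y

    -- The first child holds the least leaf, hence meets X, whose least leaf is below all of Y.
    first-child-meets : Meets c₁
    first-child-meets with minLabel-∈ (proj₂ (leaves-nonempty c₁ (wellFormed (children-reduced rc (here refl)))))
    ... | m , m∈c₁ , minLeaf≡m with ∈-leaves-lin₂⁻ {s} {X} {Y} (⊆t (∈-leavesL⁺ {cs = cs} (here refl) m∈c₁))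
    ... | inj₁ m∈X = lose m∈c₁ m∈X
    ... | inj₂ m∈Y with minLabel-∈ (proj₂ (leaves-nonempty X (wellFormed gX)))
    ... | x , x∈X , minLeafX≡x with ∈-leavesL⁻ (t⊆ (∈-++⁺ˡ x∈X))
    ... | c , c∈ , x∈c = ⊥-elim (<-irrefl refl (begin-strict
      minLeaf c₁ ≤⟨ c₁-least c∈ ⟩
      minLeaf c  ≤⟨ minLabel≤ x∈c ⟩
      toℕ x      ≡⟨ minLeafX≡x ⟨
      minLeaf X  <⟨ X<Y ⟩
      minLeaf Y  ≤⟨ minLabel≤ m∈Y ⟩
      toℕ m      ≡⟨ minLeaf≡m ⟨
      minLeaf c₁ ∎))
      where
        open ≤-Reasoning
        c₁-least : ∀ {c} → c ∈ cs → minLeaf c₁ ≤ minLeaf c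
        c₁-least (here refl) = ≤-refl
        c₁-least (there c∈) with children-sorted rc
        ... | c₁< ∷ _ = <⇒≤ (All.lookup c₁< c∈)
        X<Y : minLeaf X < minLeaf Y
        X<Y with proj₂ (proj₁ (wellFormed gt))
        ... | X<Y ∷ [-] = X<Y

    smaller : ∀ (Z : Tree n) → length (leaves Z) < length (leaves t) → length (leaves Z) ≤ N
    smaller Z Z<t with ≤-trans Z<t t-size
    ... | s≤s Z≤N = Z≤N

    bracketed-from-partition : (Σ (List (Tree n)) λ xs → Σ (List (Tree n)) λ ys →
      Interleaving xs ys cs × All Meets xs × All (¬_ ∘ Meets) ys) → Bracketed s cs t
    bracketed-from-partition (_ , _ , consʳ _ , _ , ¬meets ∷ _) = ⊥-elim (¬meets first-child-meets)
    bracketed-from-partition (_ ∷ xs′ , ys , consˡ i′ , meets-xs , ¬meets-ys)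
      with rc-xs , rc-ys ← reducedChildren-interleaving rc (consˡ i′)
      with IH s X (c₁ ∷ xs′) (smaller X (length-leaves-lin₂ˡ {s} {X} {Y} (proj₂ (leaves-nonempty Y (wellFormed gY))))) gX rc-xs
              (X⊆xs , xs⊆X)
         | IH s Y ys (smaller Y (length-leaves-lin₂ʳ {s} {X} {Y} (proj₂ (leaves-nonempty X (wellFormed gX))))) gY rc-ys
              (Y⊆ys , ys⊆Y)
      where
        i : Interleaving (c₁ ∷ xs′) ys cs
        i = consˡ i′
        xs⊆X : ∀ {a} → a ∈ leavesL (c₁ ∷ xs′) → a ∈ leaves X
        xs⊆X a∈ with ∈-leavesL⁻ a∈
        ... | c , c∈ , a∈c = let (b , b∈c , b∈X) = find (All.lookup meets-xs c∈) in
          child-inside-X (Interleaving-∈ˡ i c∈) b∈c b∈X a∈c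
        ys⊆Y : ∀ {a} → a ∈ leavesL ys → a ∈ leaves Y
        ys⊆Y a∈ with ∈-leavesL⁻ a∈
        ... | c , c∈ , a∈c = child-inside-Y (Interleaving-∈ʳ i c∈) (All.lookup ¬meets-ys c∈) a∈c
        X⊆xs : ∀ {a} → a ∈ leaves X → a ∈ leavesL (c₁ ∷ xs′)
        X⊆xs a∈X with ∈-leavesL⁻ (t⊆ (∈-++⁺ˡ a∈X))
        ... | c , c∈ , a∈c with Interleaving-∈ i c∈
        ... | inj₁ c∈xs = ∈-leavesL⁺ c∈xs a∈c
        ... | inj₂ c∈ys = ⊥-elim (X∩Y-empty a∈X (ys⊆Y (∈-leavesL⁺ c∈ys a∈c)))
        Y⊆ys : ∀ {a} → a ∈ leaves Y → a ∈ leavesL ys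
        Y⊆ys a∈Y with ∈-leavesL⁻ (t⊆ (∈-leaves-lin₂ʳ {s} {X} {Y} a∈Y))
        ... | c , c∈ , a∈c with Interleaving-∈ i c∈
        ... | inj₁ c∈xs = ⊥-elim (X∩Y-empty (xs⊆X (∈-leavesL⁺ c∈xs a∈c)) a∈Y)
        ... | inj₂ c∈ys = ∈-leavesL⁺ c∈ys a∈c
    ... | e₁ ∷ esX , btX , e₁∈ ∷ esX∈ , btX∈ , refl | esY , btY , esY∈ , btY∈ , refl
      with es , j , es∈ ← Pointwise-interleaving i′ esX∈ esY∈ =
      e₁ ∷ es , fork btX btY , e₁∈ ∷ es∈ , fork-∈-binTrees j btX∈ btY∈ , refl

    bracketed : Bracketed s cs t
    bracketed = bracketed-from-partition (partition-interleaving meets? cs)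

  completeL-two : ∀ N s t (c₁ c₂ : Tree n) cs → length (leaves t) ≤ suc N → Expanded t → ReducedChildren s (c₁ ∷ c₂ ∷ cs) →
    SameLeaves t (leavesL (c₁ ∷ c₂ ∷ cs)) → CompleteLUpTo N → Bracketed s (c₁ ∷ c₂ ∷ cs) t
  completeL-two N s (lin s′ ts) c₁ c₂ cs t-size gt rc same IH with s′ ≟B s
  completeL-two N s (lin s (X ∷ Y ∷ [])) c₁ c₂ cs t-size gt rc same IH | yes refl =
    SameSign.bracketed N s X Y c₁ (c₂ ∷ cs) t-size gt rc same IH
  completeL-two N s (lin s []) c₁ c₂ cs t-size gt rc same IH | yes refl with () ← proj₁ (shape gt)
  completeL-two N s (lin s (_ ∷ [])) c₁ c₂ cs t-size gt rc same IH | yes refl with () ← proj₁ (shape gt)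
  completeL-two N s (lin s (_ ∷ _ ∷ _ ∷ _)) c₁ c₂ cs t-size gt rc same IH | yes refl with () ← proj₁ (shape gt)
  ... | no s′≢s = ⊥-elim (children-sign-forced rc gt (s′≢s ∘ just-injective) same)
  completeL-two N s (leaf _) c₁ c₂ cs _ gt rc same _ = ⊥-elim (children-sign-forced rc gt (λ ()) same)
  completeL-two N s (gnode _ _ _) c₁ c₂ cs _ gt rc same _ = ⊥-elim (children-sign-forced rc gt (λ ()) same)

  complete-leaf : ∀ a t → Expanded t → SameLeaves t (a ∷ []) → t ∈ expansions (leaf a)
  complete-leaf a (leaf b) _ (t⊆ , _) with t⊆ (here refl)
  ... | here refl = here refl
  complete-leaf a t@(lin _ _) gt (t⊆ , _) = ⊥-elim (single-leaf-impossible gt (λ _ ()) t⊆)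
  complete-leaf a t@(gnode _ _ _) gt (t⊆ , _) = ⊥-elim (single-leaf-impossible gt (λ _ ()) t⊆)

  -- Each block of a prime node is a module of A missing a leaf.
  block-inside-block : ∀ {Q Q′ k k′} {H : Mat k} {H′ : Mat k′} {ts : Vec (Tree n) k} {ts′ : Vec (Tree n) k′} →
    GoodTree Q (gnode k H ts) → GoodTree Q′ (gnode k′ H′ ts′) →
    (∀ {a} → a ∈ leavesV ts → a ∈ leavesV ts′) → (∀ {a} → a ∈ leavesV ts′ → a ∈ leavesV ts) →
    ∀ i → Σ (Fin k′) λ j → ∀ {b} → b ∈ leaves (lookup ts i) → b ∈ leaves (lookup ts′ j)
  block-inside-block {k = k} {k′} {ts = ts} {ts′} g g′ ⊆′ ⊇′ i = j , B⊆j
    where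
      B : Tree n
      B = lookup ts i
      b₀ : Σ (Fin n) λ b → b ∈ leaves B
      b₀ = block-leaf g i
      j : Fin k′
      j = proj₁ (∈-leavesV⁻ {ts = ts′} (⊆′ (∈-leavesV⁺ {ts = ts} i (proj₂ b₀))))
      b₀∈j : proj₁ b₀ ∈ leaves (lookup ts′ j)
      b₀∈j = proj₂ (∈-leavesV⁻ {ts = ts′} (⊆′ (∈-leavesV⁺ {ts = ts} i (proj₂ b₀))))
      B-module : IsModuleOn (leavesV ts′) (memT B)
      B-module x∈ _ _ px py pz with ∈-leavesV⁻ {ts = ts} (⊇′ x∈)
      ... | i′ , x∈i′ =
        trans (A-across-gnode g i′≢i x∈i′ (memT-true⁻ B py)) (sym (A-across-gnode g i′≢i x∈i′ (memT-true⁻ B pz)))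
        where i′≢i : i′ ≢ i
              i′≢i refl = memT-false⁻ B px x∈i′
      q : Σ (Fin k) λ q → q ≢ i × q ≢ i
      q = third-vertex (proj₁ (proj₁ (primes g))) i i
      w : Σ (Fin n) λ a → a ∈ leaves (lookup ts (proj₁ q))
      w = block-leaf g (proj₁ q)
      w∉B : memT B (proj₁ w) ≡ false
      w∉B = memT-false B λ w∈B →
        proj₁ (proj₂ q) (Unique-leavesV-sameIndex {ts = ts} (uniqueLeaves g) (proj₁ q) i (proj₂ w) w∈B)
      B⊆j : ∀ {b} → b ∈ leaves B → b ∈ leaves (lookup ts′ j)
      B⊆j {b} b∈ with ∈-leavesV⁻ {ts = ts′} (⊆′ (∈-leavesV⁺ {ts = ts} i b∈))
      ... | j′ , b∈j′ = subst (λ l → b ∈ leaves (lookup ts′ l))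
        (sym (module-inside-block g′ (memT B) B-module (⊆′ (∈-leavesV⁺ {ts = ts} (proj₁ q) (proj₂ w))) w∉B
               b₀∈j b∈j′ (memT-true B (proj₂ b₀)) (memT-true B b∈))) b∈j′

  module BlockMatching {Q Q′ k k′} {H : Mat k} {H′ : Mat k′} {ts : Vec (Tree n) k} {ts′ : Vec (Tree n) k′}
    (g : GoodTree Q (gnode k H ts)) (g′ : GoodTree Q′ (gnode k′ H′ ts′))
    (⊆′ : ∀ {a} → a ∈ leavesV ts → a ∈ leavesV ts′) (⊇′ : ∀ {a} → a ∈ leavesV ts′ → a ∈ leavesV ts) where

    match : Fin k → Fin k′
    match i = proj₁ (block-inside-block g g′ ⊆′ ⊇′ i)

    ⊆match : ∀ i {b} → b ∈ leaves (lookup ts i) → b ∈ leaves (lookup ts′ (match i))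
    ⊆match i = proj₂ (block-inside-block g g′ ⊆′ ⊇′ i)

    ⊇match : ∀ i {b} → b ∈ leaves (lookup ts′ (match i)) → b ∈ leaves (lookup ts i)
    ⊇match i {b} b∈ = subst (λ l → b ∈ leaves (lookup ts l)) back (proj₂ (block-inside-block g′ g ⊇′ ⊆′ (match i)) b∈)
      where
        b₀ : Σ (Fin n) λ b → b ∈ leaves (lookup ts i)
        b₀ = block-leaf g i
        back : proj₁ (block-inside-block g′ g ⊇′ ⊆′ (match i)) ≡ i
        back = Unique-leavesV-sameIndex {ts = ts} (uniqueLeaves g) _ i
          (proj₂ (block-inside-block g′ g ⊇′ ⊆′ (match i)) (⊆match i (proj₂ b₀))) (proj₂ b₀)

    minLeaf-match : ∀ i → minLeaf (lookup ts i) ≡ minLeaf (lookup ts′ (match i))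
    minLeaf-match i = minLabel-cong (⊆match i) (⊇match i)

    minLeaves-⊆ : ∀ {z} → z ∈ map minLeaf (toList ts) → z ∈ map minLeaf (toList ts′)
    minLeaves-⊆ z∈ with ∈-map⁻ minLeaf z∈
    ... | u , u∈ , refl with ∈-toList⁻ u∈
    ... | i , refl = subst (_∈ map minLeaf (toList ts′)) (sym (minLeaf-match i)) (∈-map⁺ minLeaf (∈-toList⁺ ts′ (match i)))

  gnode-sorted : ∀ {Q k H ts} → GoodTree Q (gnode k H ts) → AllPairs _<_ (map minLeaf (toList ts))
  gnode-sorted g = Linked⇒AllPairs <-trans (proj₂ (proj₂ (proj₁ (wellFormed g))))

  gnode-minLeaves-≡ : ∀ {Q Q′ k k′} {H : Mat k} {H′ : Mat k′} {ts : Vec (Tree n) k} {ts′ : Vec (Tree n) k′} →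
    (g : GoodTree Q (gnode k H ts)) (g′ : GoodTree Q′ (gnode k′ H′ ts′)) →
    (⊆′ : ∀ {a} → a ∈ leavesV ts → a ∈ leavesV ts′) (⊇′ : ∀ {a} → a ∈ leavesV ts′ → a ∈ leavesV ts) →
    map minLeaf (toList ts) ≡ map minLeaf (toList ts′)
  gnode-minLeaves-≡ g g′ ⊆′ ⊇′ =
    sorted-≡ id (gnode-sorted g) (gnode-sorted g′)
      (BlockMatching.minLeaves-⊆ g g′ ⊆′ ⊇′) (BlockMatching.minLeaves-⊆ g′ g ⊇′ ⊆′)

  gnode-arity-≡ : ∀ {Q Q′ k k′} {H : Mat k} {H′ : Mat k′} {ts : Vec (Tree n) k} {ts′ : Vec (Tree n) k′} →
    GoodTree Q (gnode k′ H′ ts′) → GoodTree Q′ (gnode k H ts) →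
    (∀ {a} → a ∈ leavesV ts′ → a ∈ leavesV ts) → (∀ {a} → a ∈ leavesV ts → a ∈ leavesV ts′) → k′ ≡ k
  gnode-arity-≡ {k = k} {k′} {ts = ts} {ts′} g′ g ⊆′ ⊇′ = begin
    k′                                ≡⟨ length-toList ts′ ⟨
    length (toList ts′)               ≡⟨ length-map minLeaf (toList ts′) ⟨
    length (map minLeaf (toList ts′)) ≡⟨ cong length (gnode-minLeaves-≡ g′ g ⊆′ ⊇′) ⟩
    length (map minLeaf (toList ts))  ≡⟨ length-map minLeaf (toList ts) ⟩
    length (toList ts)                ≡⟨ length-toList ts ⟩
    k                                 ∎
    where open ≡-Reasoning

  gnode-irreflexive : ∀ {Q k H ts} → GoodTree Q (gnode k H ts) → ∀ i → matAdj H i i ≡ false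
  gnode-irreflexive g = proj₂ (proj₁ (proj₂ (proj₁ (wellFormed g))))

  complete-gnode-same : ∀ N k (H H′ : Mat k) (ts ts′ : Vec (Tree n) k) → length (leavesV ts′) ≤ suc N →
    Expanded (gnode k H′ ts′) → Reduced (gnode k H ts) → SameLeaves (gnode k H′ ts′) (leavesV ts) → CompleteUpTo N →
    gnode k H′ ts′ ∈ expansions (gnode k H ts)
  complete-gnode-same N k H H′ ts ts′ t-size gt gτ (t⊆ , ⊆t) IH =
    subst (λ H″ → gnode k H″ ts′ ∈ map (gnode k H) (expansionsV ts)) H≡H′
      (∈-map⁺ (gnode k H) (∈-expansionsV⁺ {ts = ts} (extensional⇒inductive (ext children-complete))))
    where
      open BlockMatching gt gτ t⊆ ⊆t
      match≡id : ∀ i → match i ≡ i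
      match≡id i = sorted⇒lookup-injective minLeaf ts (gnode-sorted gτ) (match i) i
        (trans (sym (minLeaf-match i)) (map-toList-≡⇒lookup minLeaf ts′ ts (gnode-minLeaves-≡ gt gτ t⊆ ⊆t) i))
      same-block : ∀ i → SameLeaves (lookup ts′ i) (leaves (lookup ts i))
      same-block i = (λ {b} b∈ → subst (λ l → b ∈ leaves (lookup ts l)) (match≡id i) (⊆match i b∈))
                   , (λ {b} b∈ → ⊇match i (subst (λ l → b ∈ leaves (lookup ts l)) (sym (match≡id i)) b∈))
      H-entry : ∀ i j → matAdj H i j ≡ matAdj H′ i j
      H-entry i j with i ≟ j
      ... | yes refl = trans (gnode-irreflexive gτ i) (sym (gnode-irreflexive gt i))
      ... | no i≢j = trans (sym (A-across-gnode gτ i≢j (proj₂ (block-leaf gτ i)) (proj₂ (block-leaf gτ j))))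
                           (A-across-gnode gt i≢j (proj₂ (same-block i) (proj₂ (block-leaf gτ i)))
                                                   (proj₂ (same-block j) (proj₂ (block-leaf gτ j))))
      H≡H′ : H ≡ H′
      H≡H′ = Pointwise-≡⇒≡ (extensional⇒inductive (ext λ i → Pointwise-≡⇒≡ (extensional⇒inductive (ext (H-entry i)))))
      children-complete : ∀ i → lookup ts′ i Expands lookup ts i
      children-complete i = IH (lookup ts′ i) (lookup ts i)
        (≤-pred (≤-trans (length-leaves-lookup< ts′ (block-leaf gt) (proj₁ (proj₁ (wellFormed gt))) i) t-size))
        (good-lookup gt i) (good-lookup gτ i) (same-block i)

  complete-gnode : ∀ N k (H : Mat k) (ts : Vec (Tree n) k) t → length (leaves t) ≤ suc N → Expanded t → Reduced (gnode k H ts) →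
    SameLeaves t (leavesV ts) → CompleteUpTo N → t ∈ expansions (gnode k H ts)
  complete-gnode N k H ts (leaf a) _ _ gτ (_ , ⊆t) _ = ⊥-elim (single-leaf-impossible gτ (λ _ ()) ⊆t)
  complete-gnode N k H ts (lin s cs) _ gt gτ (t⊆ , ⊆t) _ = ⊥-elim (lin-sign-forced gt gτ (λ ()) (⊆t , t⊆))
  complete-gnode N k H ts (gnode k′ H′ ts′) t-size gt gτ same IH
    with refl ← gnode-arity-≡ gt gτ (proj₁ same) (proj₂ same) = complete-gnode-same N k H H′ ts ts′ t-size gt gτ same IH

  mutual
    complete : ∀ N → CompleteUpTo N
    complete zero t _ t-size gt _ _ with () ← ≤-trans (∈-length (proj₂ (leaves-nonempty t (wellFormed gt)))) t-size
    complete (suc N) t (leaf a) _ gt _ same = complete-leaf a t gt same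
    complete (suc N) t (lin s cs) t-size gt gτ same = bracketed⇒expansion (completeL (suc N) s t cs t-size gt (reducedChildren gτ) same)
    complete (suc N) t (gnode k H ts) t-size gt gτ same = complete-gnode N k H ts t t-size gt gτ same (complete N)

    completeL : ∀ N → CompleteLUpTo N
    completeL zero _ t _ t-size gt _ _ with () ← ≤-trans (∈-length (proj₂ (leaves-nonempty t (wellFormed gt)))) t-size
    completeL (suc N) s t [] _ gt _ (t⊆ , _) with () ← t⊆ (proj₂ (leaves-nonempty t (wellFormed gt)))
    completeL (suc N) s t (c ∷ []) t-size gt rc (t⊆ , ⊆t) =
      t ∷ [] , tip t ,
      complete (suc N) t c t-size gt (children-reduced rc (here refl)) (c⊆ ∘ t⊆ , ⊆t ∘ ∈-++⁺ˡ) ∷ [] ,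
      here refl , refl
      where
        c⊆ : ∀ {a} → a ∈ leaves c ++ [] → a ∈ leaves c
        c⊆ a∈ with ∈-++⁻ (leaves c) a∈
        ... | inj₁ a∈c = a∈c
    completeL (suc N) s t (c₁ ∷ c₂ ∷ cs) t-size gt rc same = completeL-two N s t c₁ c₂ cs t-size gt rc same (completeL N)

module _ {n : ℕ} where

  Unique-leaves : ∀ (t : Tree n) → leaves t ↭ allFin n → Unique (leaves t)
  Unique-leaves t perm = Unique-resp-↭ (↭-sym perm) (UniqueP.allFin⁺ n)

  length-leaves : ∀ (t : Tree n) → leaves t ↭ allFin n → length (leaves t) ≡ n
  length-leaves t perm = trans (↭-length perm) (length-tabulate id)

  edges-expansion : ∀ {e τ : Tree n} → e IsExpansionOf τ → leaves τ ↭ allFin n → edges e ≡ 2 * n ∸ 2 ∸ nonlinExcess τ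
  edges-expansion {e} {τ} e≈ perm = sym (begin
    2 * n ∸ 2 ∸ nonlinExcess τ                        ≡⟨ cong (λ m → 2 * m ∸ 2 ∸ nonlinExcess τ) (length-leaves τ perm) ⟨
    2 * length (leaves τ) ∸ 2 ∸ nonlinExcess τ        ≡⟨ cong (λ m → m ∸ 2 ∸ nonlinExcess τ) (edges≡ e≈) ⟨
    edges e + nonlinExcess τ + 2 ∸ 2 ∸ nonlinExcess τ ≡⟨ cong (_∸ nonlinExcess τ) (m+n∸n≡m (edges e + nonlinExcess τ) 2) ⟩
    edges e + nonlinExcess τ ∸ nonlinExcess τ         ≡⟨ m+n∸n≡m (edges e) (nonlinExcess τ) ⟩
    edges e                                           ∎)
    where open ≡-Reasoning

  module _ (G : LabeledGraph n) (τ : Tree n) (τ-mdt : IsModDecTree G τ) where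
    open Completeness (LabeledGraph.adj G) (LabeledGraph.sym G)
    open Realizing (LabeledGraph.adj G) (LabeledGraph.sym G)

    private
      τ-wf : Every WFLocal τ
      τ-wf = proj₁ (proj₁ τ-mdt)
      τ-leaves : leaves τ ↭ allFin n
      τ-leaves = proj₂ (proj₁ τ-mdt)
      τ-realizes : Realizes τ G
      τ-realizes = proj₁ (proj₂ τ-mdt)
      τ-prime : Every PrimeLocal τ
      τ-prime = proj₁ (proj₂ (proj₂ τ-mdt))
      τ-reduced : Every ReducedLocal τ
      τ-reduced = proj₂ (proj₂ (proj₂ τ-mdt))

    expanded⇒expansion : ∀ {t} → IsExpandedTree G t → t ∈ expansions τ
    expanded⇒expansion {t} ((t-wf , t-leaves) , t-realizes , t-prime , t-binary) =
      complete (length (leaves t)) t τ ≤-refl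
        (goodTree t-wf t-prime t-binary (Unique-leaves t t-leaves) (λ {a} {b} _ _ → t-realizes a b))
        (goodTree τ-wf τ-prime τ-reduced (Unique-leaves τ τ-leaves) (λ {a} {b} _ _ → τ-realizes a b))
        (∈-resp-↭ (↭-trans t-leaves (↭-sym τ-leaves)) , ∈-resp-↭ (↭-trans τ-leaves (↭-sym t-leaves)))

    expansion-isExpansionOf : ∀ {t} → t ∈ expansions τ → t IsExpansionOf τ
    expansion-isExpansionOf = expansions-sound τ τ-wf τ-prime (Unique-leaves τ τ-leaves)

    expansion⇒expanded : ∀ {t} → t ∈ expansions τ → IsExpandedTree G t
    expansion⇒expanded {t} t∈ =
      (isWF t≈ , ↭-trans (leaves↭ t≈) τ-leaves) ,
      (λ a b → trans (adj≡ t≈ (∈τ a) (∈τ b)) (τ-realizes a b)) , isPrime t≈ , isBinary t≈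
      where
        t≈ : t IsExpansionOf τ
        t≈ = expansion-isExpansionOf t∈
        ∈τ : ∀ a → a ∈ leaves τ
        ∈τ a = ∈-resp-↭ (↭-sym τ-leaves) (∈-allFin a)

corollary2p27 : ∀ {n : ℕ} (G : LabeledGraph n) (τ : Tree n) → IsModDecTree G τ →
    Σ (List (Tree n)) (λ L → Unique L
        × length L ≡ product (map (λ d → (2 * d ∸ 3) !!) (linDegrees τ))
        × (∀ t → IsExpandedTree G t ⇔ (t ∈ L)))
    × (∀ t → IsExpandedTree G t →
        edges t ≡ 2 * n ∸ 2 ∸ sum (map (λ e → e ∸ 2) (nonlinDegrees τ)))
corollary2p27 G τ τ-mdt@((τ-wf , τ-leaves) , _ , τ-prime , τ-reduced) =
  ( expansions τ
  , Unique-expansions τ τ-wf τ-prime τ-reduced (Unique-leaves τ τ-leaves)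
  , length-expansions τ τ-wf
  , λ t → mk⇔ (expanded⇒expansion G τ τ-mdt) (expansion⇒expanded G τ τ-mdt) )
  , λ t t-expanded →
      edges-expansion (expansion-isExpansionOf G τ τ-mdt (expanded⇒expansion G τ τ-mdt {t} t-expanded)) τ-leaves
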